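{- Let $p$ be an odd prime and $n\geq 2$ an integer. Let $\underline{\mu}=(\mu(\tau))_{\tau\in\mathbb{Z}/p^n\mathbb{Z}}$ be a tuple of non-negative integers with $|\mathsf{T}(\underline{\mu})|=|\overline{\mathsf{T}}(\underline{\mu})|$, and let $\underline{\ell}=(\ell_\tau)_{\tau\in\mathsf{T}(\underline{\mu})}$ be a tuple of integers with $|\ell_\tau|<p$ for all $\tau\in\mathsf{T}(\underline{\mu})$ and $\underline{\ell}\neq\underline{0}$. Then, uniformly, $$\mathsf{N}(\underline{\mu},\underline{\ell};w)\ll|\mathsf{T}(\underline{\mu})|\,2^{|\mathsf{T}(\underline{\mu})|}$$ for every $w$ modulo $p$, where the implied constant is absolute.
   Context: $\mathsf{T}(\underline{\mu})\coloneqq\{\tau\in\mathbb{Z}/p^n\mathbb{Z}:\mu(\tau)\geq1\}$ and $\overline{\mathsf{T}}(\underline{\mu})\coloneqq\{\tau\bmod p:\tau\in\mathsf{T}(\underline{\mu})\}\subset\mathbb{Z}/p\mathbb{Z}$. Let $\mathsf{B}_{p^n}(\underline{\mu})$ be the set of tuples $\underline{b}=(b_\tau)_{\tau\in\mathsf{T}(\underline{\mu})}$ of integers in $\{1,\dots,(p-1)/2\}$ such that $b_\tau^2-\tau\equiv b_{\tau'}^2-\tau'\pmod p$ for all $\tau,\tau'\in\mathsf{T}(\underline{\mu})$ and $p\nmid b_\tau^2-\tau$ for all $\tau\in\mathsf{T}(\underline{\mu})$. For $j\in\{1,\dots,n-1\}$ set $m_{\underline{b},\underline{\ell}}(j,j)\coloneqq\sum_{\tau\in\mathsf{T}(\underline{\mu})}\ell_\tau\overline{b_\tau}^{\,2j-1}$,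 where $\overline{b_\tau}$ is the inverse of $b_\tau$ modulo $p$. Define $$\mathsf{N}(\underline{\mu},\underline{\ell};w)\coloneqq\#\left\{\underline{b}\in\mathsf{B}_{p^n}(\underline{\mu}):\ m_{\underline{b},\underline{\ell}}(1,1)\equiv w\ (\mathrm{mod}\ p),\ m_{\underline{b},\underline{\ell}}(j,j)\equiv0\ (\mathrm{mod}\ p)\ \forall j\in\{2,\dots,n-1\}\right\}.$$ -}

module Defs where

open import Data.Bool using (Bool; true; false; _∧_; not)
open import Data.Nat as ℕ using (ℕ; zero; suc; _∸_; _^_; _≤ᵇ_; _/_)
open import Data.Nat.Divisibility using (_∣?_)
open import Data.Integer as ℤ using (ℤ; +_; ∣_∣; _-_)
open import Data.List using (List; []; _∷_; [_]; map; concatMap; filterᵇ; length; upTo; zip; foldr; head)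
open import Data.Bool.ListAction using (all; any)
open import Data.Maybe using (Maybe; just; nothing)
open import Data.Product using (_×_; _,_; proj₁; proj₂)
open import Relation.Nullary using (does)

dvdℤ : ℕ → ℤ → Bool
dvdℤ p z = does (p ∣? ∣ z ∣)

congᵇ : ℕ → ℕ → ℕ → Bool
congᵇ p a b = dvdℤ p (+ a - + b)

-- T(μ) : the list of τ ∈ {0,…,p^n-1} (representing ℤ/p^nℤ) with μ(τ) ≥ 1
Tlist : ℕ → ℕ → (ℕ → ℕ) → List ℕ
Tlist p n μ = filterᵇ (λ τ → 1 ≤ᵇ μ τ) (upTo (p ^ n))

cardT : ℕ → ℕ → (ℕ → ℕ) → ℕ
cardT p n μ = length (Tlist p n μ)

cardTbar : ℕ → ℕ → (ℕ → ℕ) → ℕ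
cardTbar p n μ =
  length (filterᵇ (λ r → any (λ τ → congᵇ p τ r) (Tlist p n μ)) (upTo p))

-- the inverse of b modulo p: the least x ∈ {0,…,p-1} with b·x ≡ 1 (mod p)
-- (default 0 if none exists; never used when p is prime and p ∤ b)
invMod : ℕ → ℕ → ℕ
invMod p b with head (filterᵇ (λ x → dvdℤ p (+ (b ℕ.* x) - + 1)) (upTo p))
... | just x  = x
... | nothing = 0

tuples : ℕ → List ℕ → List (List ℕ)
tuples zero    vs = [ [] ]
tuples (suc k) vs = concatMap (λ v → map (v ∷_) (tuples k vs)) vs

halfRange : ℕ → List ℕ
halfRange p = map suc (upTo ((p ∸ 1) / 2))

shift : ℕ × ℕ → ℤ
shift (τ , b) = + (b ℕ.* b) - + τ

-- membership of B_{p^n}(μ) for a tuple given as a list of pairs (τ , b_τ), τ ∈ T(μ)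
inB : ℕ → List (ℕ × ℕ) → Bool
inB p tb =
  all (λ x → all (λ y → dvdℤ p (shift x - shift y)) tb) tb
  ∧ all (λ x → not (dvdℤ p (shift x))) tb

mjj : ℕ → (ℕ → ℤ) → List (ℕ × ℕ) → ℕ → ℤ
mjj p ℓ tb j =
  foldr ℤ._+_ (+ 0) (map (λ x → ℓ (proj₁ x) ℤ.* + (invMod p (proj₂ x) ^ (2 ℕ.* j ∸ 1))) tb)

goodᵇ : ℕ → ℕ → (ℕ → ℤ) → ℤ → List (ℕ × ℕ) → Bool
goodᵇ p n ℓ w tb =
  inB p tb
  ∧ dvdℤ p (mjj p ℓ tb 1 - w)
  ∧ all (λ j → dvdℤ p (mjj p ℓ tb j)) (filterᵇ (λ j → 2 ≤ᵇ j) (upTo n))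

Ncount : ℕ → ℕ → (ℕ → ℕ) → (ℕ → ℤ) → ℤ → ℕ
Ncount p n μ ℓ w =
  length (filterᵇ (goodᵇ p n ℓ w)
    (map (zip (Tlist p n μ)) (tuples (cardT p n μ) (halfRange p))))

{-# OPTIONS --safe #-}
module Submission where

-- A tuple counted by N is determined by its common shift c ≡ b_τ² − τ (mod p), since each
-- b_τ ∈ {1, …, (p−1)/2} is the unique square root of c + τ in that range.  Every such c is a
-- root mod p of one polynomial P: clear denominators in w − Σ ℓ_τ / b_τ and eliminate the
-- square roots b_τ = √(c + τ) one at a time by multiplying with the conjugate, which roughly
-- doubles the degree each time, so deg P ≤ k 2^k for k = |T|.  P is not zero mod p: at
-- c = −τ₀, where ℓ_τ₀ ≢ 0, the root √(c + τ₀) vanishes and P becomes a power of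
-- ℓ_τ₀² ∏_{σ ≠ τ₀} (σ − τ₀), a unit because |T| = |T̄| makes the τ distinct mod p.
-- Only the condition m(1,1) ≡ w is needed.

open import Defs

module _ where
  open import Data.Bool using (Bool; true; false; T; _∨_)
  open import Data.Bool.ListAction using (all; any)
  open import Data.Bool.Properties using (T-∧)
  open import Data.Empty using (⊥-elim)
  open import Data.Integer using (ℤ; +_; -_; _+_; _-_; _*_; 0ℤ; 1ℤ; ∣_∣)
  open import Data.Integer.DivMod using (_%ℕ_; _/ℕ_; a≡a%ℕn+[a/ℕn]*n; n%ℕd<d)
  open import Data.Integer.Divisibility.Signed
    using (_∣_; divides; ∣ᵤ⇒∣; ∣⇒∣ᵤ; ∣m⇒∣-m; ∣m∣n⇒∣m+n; ∣m⇒∣m*n; ∣n⇒∣m*n)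
  import Data.Integer.Properties as ℤₚ
  open import Data.Integer.Tactic.RingSolver using (solve-∀)
  open import Data.List using (List; []; _∷_; length; map; filterᵇ; upTo; head; zip; _++_)
  open import Data.List.Membership.Propositional using (_∈_)
  open import Data.List.Membership.Propositional.Properties using (∈-upTo⁺; ∈-upTo⁻; ∈-map⁻; ∈-∃++)
  open import Data.List.Properties using (length-map; length-++; filter-none; ∷-injectiveˡ; ∷-injectiveʳ)
  open import Data.List.Relation.Binary.Disjoint.Propositional using (Disjoint)
  open import Data.List.Relation.Binary.Pointwise as Pointwise using (Pointwise; []; _∷_)
  open import Data.List.Relation.Unary.All as All using (All; []; _∷_)
  import Data.List.Relation.Unary.All.Properties as Allₚ
  open import Data.List.Relation.Unary.AllPairs as AllPairs using (AllPairs; []; _∷_)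
  import Data.List.Relation.Unary.AllPairs.Properties as APₚ
  open import Data.List.Relation.Unary.Any as Any using (here; there)
  open import Data.List.Relation.Unary.Any.Properties using (any⁺)
  open import Data.List.Relation.Unary.Unique.Propositional using (Unique)
  import Data.List.Relation.Unary.Unique.Propositional.Properties as Uniqueₚ
  open import Data.Maybe using (just)
  open import Data.Nat as ℕ using (ℕ; zero; suc; z≤n; s≤s; NonZero)
  open import Data.Nat.Coprimality using (prime⇒coprime; coprime-Bézout)
  import Data.Nat.Divisibility as ℕ∣
  import Data.Nat.DivMod as ℕ/
  open import Data.Nat.GCD using (module Bézout)
  open import Data.Nat.ListAction using (product)
  open import Data.Nat.Primality using (Prime; euclidsLemma; prime⇒nonZero; prime⇒nonTrivial)
  import Data.Nat.Properties as ℕₚ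
  open import Data.Nat.Tactic.RingSolver using () renaming (solve-∀ to ℕ-solve-∀)
  open import Data.Product using (∃; _×_; _,_; proj₁; proj₂)
  open import Data.Sum using (_⊎_; inj₁; inj₂)
  open import Function using (_∘_)
  open import Function.Bundles using (Equivalence)
  open import Relation.Binary using (Setoid; tri<; tri≈; tri>)
  open import Relation.Binary.PropositionalEquality
  open import Relation.Nullary using (¬_; yes; no)
  open import Relation.Nullary.Decidable using (T?)

  module Congruence (p : ℕ) where

    infix 4 _≈_ _≉_
    record _≈_ (x y : ℤ) : Set where
      constructor mk
      field divides-difference : + p ∣ x - y
    open _≈_ public

    _≉_ : ℤ → ℤ → Set
    x ≉ y = ¬ x ≈ y

    private
      -[x-y]≡y-x : ∀ x y → - (x - y) ≡ y - x
      -[x-y]≡y-x = solve-∀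
      [x-y]+[y-z]≡x-z : ∀ x y z → (x - y) + (y - z) ≡ x - z
      [x-y]+[y-z]≡x-z = solve-∀
      difference-of-sums : ∀ x y x′ y′ → (x - x′) + (y - y′) ≡ (x + y) - (x′ + y′)
      difference-of-sums = solve-∀
      difference-of-products : ∀ x y x′ y′ → x * (y - y′) + (x - x′) * y′ ≡ x * y - x′ * y′
      difference-of-products = solve-∀
      x-0≡x : ∀ x → x - 0ℤ ≡ x
      x-0≡x = solve-∀

    ≈-reflexive : ∀ {x y} → x ≡ y → x ≈ y
    ≈-reflexive {x} refl =
      mk (divides 0ℤ (trans (ℤₚ.+-inverseʳ x) (sym (ℤₚ.*-zeroˡ (+ p)))))

    ≈-refl : ∀ {x} → x ≈ x
    ≈-refl = ≈-reflexive refl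

    ≈-sym : ∀ {x y} → x ≈ y → y ≈ x
    ≈-sym {x} {y} (mk d) = mk (subst (+ p ∣_) (-[x-y]≡y-x x y) (∣m⇒∣-m d))

    ≈-trans : ∀ {x y z} → x ≈ y → y ≈ z → x ≈ z
    ≈-trans {x} {y} {z} (mk d) (mk e) =
      mk (subst (+ p ∣_) ([x-y]+[y-z]≡x-z x y z) (∣m∣n⇒∣m+n d e))

    ≈-setoid : Setoid _ _
    ≈-setoid = record
      { Carrier = ℤ ; _≈_ = _≈_
      ; isEquivalence = record { refl = ≈-refl ; sym = ≈-sym ; trans = ≈-trans } }

    +-cong : ∀ {x y x′ y′} → x ≈ x′ → y ≈ y′ → x + y ≈ x′ + y′
    +-cong {x} {y} {x′} {y′} (mk d) (mk e) =
      mk (subst (+ p ∣_) (difference-of-sums x y x′ y′) (∣m∣n⇒∣m+n d e))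

    *-cong : ∀ {x y x′ y′} → x ≈ x′ → y ≈ y′ → x * y ≈ x′ * y′
    *-cong {x} {y} {x′} {y′} (mk d) (mk e) =
      mk (subst (+ p ∣_) (difference-of-products x y x′ y′) (∣m∣n⇒∣m+n (∣n⇒∣m*n x e) (∣m⇒∣m*n y′ d)))

    -‿cong : ∀ {x x′} → x ≈ x′ → - x ≈ - x′
    -‿cong {x} {x′} (mk d) = mk (subst (+ p ∣_) (ℤₚ.neg-distrib-+ x (- x′)) (∣m⇒∣-m d))

    ∣⇒≈0 : ∀ {x} → + p ∣ x → x ≈ 0ℤ
    ∣⇒≈0 {x} d = mk (subst (+ p ∣_) (sym (x-0≡x x)) d)

    ≈0⇒∣ : ∀ {x} → x ≈ 0ℤ → + p ∣ x
    ≈0⇒∣ {x} (mk d) = subst (+ p ∣_) (x-0≡x x) d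

    dvdℤ-sound : ∀ z → T (dvdℤ p z) → + p ∣ z
    dvdℤ-sound z t with p ℕ∣.∣? ∣ z ∣
    ... | yes d = ∣ᵤ⇒∣ d

    dvdℤ-complete : ∀ z → + p ∣ z → T (dvdℤ p z)
    dvdℤ-complete z d with p ℕ∣.∣? ∣ z ∣
    ... | yes _ = _
    ... | no ∤ = ⊥-elim (∤ (∣⇒∣ᵤ d))

    congᵇ-sound : ∀ a b → T (congᵇ p a b) → + a ≈ + b
    congᵇ-sound a b t = mk (dvdℤ-sound _ t)

    congᵇ-complete : ∀ a b → + a ≈ + b → T (congᵇ p a b)
    congᵇ-complete a b (mk d) = dvdℤ-complete _ d

  head-filterᵇ : ∀ {A : Set} (f : A → Bool) {x : A} {xs : List A} → x ∈ xs → T (f x) →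
                 ∃ λ y → head (filterᵇ f xs) ≡ just y × T (f y)
  head-filterᵇ f {xs = y ∷ xs} x∈ fx with f y in fy
  ... | true = y , refl , subst T (sym fy) _
  head-filterᵇ f (here refl) fx | false = ⊥-elim (subst T fy fx)
  head-filterᵇ f (there x∈) fx | false = head-filterᵇ f x∈ fx

  module PrimeModulus {p : ℕ} (prime : Prime p) where
    open Congruence p

    instance
      p-nonZero : NonZero p
      p-nonZero = prime⇒nonZero prime

    1<p : 1 ℕ.< p
    1<p = ℕ.nonTrivial⇒n>1 p {{prime⇒nonTrivial prime}}

    x*y≈0⇒x≈0⊎y≈0 : ∀ {x y} → x * y ≈ 0ℤ → x ≈ 0ℤ ⊎ y ≈ 0ℤ
    x*y≈0⇒x≈0⊎y≈0 {x} {y} xy≈0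
      with euclidsLemma ∣ x ∣ ∣ y ∣ prime (subst (p ℕ∣.∣_) (ℤₚ.abs-* x y) (∣⇒∣ᵤ (≈0⇒∣ xy≈0)))
    ... | inj₁ p∣x = inj₁ (∣⇒≈0 (∣ᵤ⇒∣ p∣x))
    ... | inj₂ p∣y = inj₂ (∣⇒≈0 (∣ᵤ⇒∣ p∣y))

    x*y≉0 : ∀ {x y} → x ≉ 0ℤ → y ≉ 0ℤ → x * y ≉ 0ℤ
    x*y≉0 x≉0 y≉0 xy≈0 with x*y≈0⇒x≈0⊎y≈0 xy≈0
    ... | inj₁ x≈0 = x≉0 x≈0
    ... | inj₂ y≈0 = y≉0 y≈0

    ∣z∣<p⇒z≉0 : ∀ {z} → z ≢ 0ℤ → ∣ z ∣ ℕ.< p → z ≉ 0ℤ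
    ∣z∣<p⇒z≉0 {z} z≢0 ∣z∣<p z≈0 =
      ℕ∣.>⇒∤ {{ℕ.≢-nonZero (z≢0 ∘ ℤₚ.∣i∣≡0⇒i≡0)}} ∣z∣<p (∣⇒∣ᵤ (≈0⇒∣ z≈0))

    0<n<p⇒n≉0 : ∀ {n} → 0 ℕ.< n → n ℕ.< p → + n ≉ 0ℤ
    0<n<p⇒n≉0 0<n = ∣z∣<p⇒z≉0 (ℕₚ.<⇒≢ 0<n ∘ sym ∘ ℤₚ.+-injective)

    1≉0 : 1ℤ ≉ 0ℤ
    1≉0 = 0<n<p⇒n≉0 (s≤s z≤n) 1<p

    m<n<p⇒n≉m : ∀ {m n} → m ℕ.< n → n ℕ.< p → + n ≉ + m
    m<n<p⇒n≉m {m} {n} m<n n<p (mk d) =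
      0<n<p⇒n≉0 (ℕₚ.m<n⇒0<n∸m m<n) (ℕₚ.≤-<-trans (ℕₚ.m∸n≤m n m) n<p)
        (∣⇒≈0 (subst (+ p ∣_) (trans (ℤₚ.m-n≡m⊖n n m) (ℤₚ.⊖-≥ (ℕₚ.<⇒≤ m<n))) d))

    <p-≈-injective : ∀ {i j} → i ℕ.< p → j ℕ.< p → + i ≈ + j → i ≡ j
    <p-≈-injective {i} {j} i<p j<p i≈j with ℕₚ.<-cmp i j
    ... | tri< i<j _ _ = ⊥-elim (m<n<p⇒n≉m i<j j<p (≈-sym i≈j))
    ... | tri≈ _ i≡j _ = i≡j
    ... | tri> _ _ j<i = ⊥-elim (m<n<p⇒n≉m j<i i<p i≈j)

    half : ℕ
    half = (p ℕ.∸ 1) ℕ./ 2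

    half+half<p : half ℕ.+ half ℕ.< p
    half+half<p = begin-strict
        half ℕ.+ half      ≡⟨ cong (half ℕ.+_) (sym (ℕₚ.+-identityʳ half)) ⟩
        2 ℕ.* half         ≡⟨ ℕₚ.*-comm 2 half ⟩
        half ℕ.* 2         ≤⟨ ℕ/.m/n*n≤m (p ℕ.∸ 1) 2 ⟩
        p ℕ.∸ 1            <⟨ ℕₚ.∸-monoʳ-< (s≤s z≤n) (ℕₚ.<⇒≤ 1<p) ⟩
        p ℕ.∸ 0            ∎
      where open ℕₚ.≤-Reasoning

    ∈-halfRange⁻ : ∀ {b} → b ∈ halfRange p → 0 ℕ.< b × b ℕ.≤ half
    ∈-halfRange⁻ b∈ with ∈-map⁻ suc b∈
    ... | i , i∈ , refl = s≤s z≤n , ∈-upTo⁻ i∈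

    ∈-halfRange⇒<p : ∀ {b} → b ∈ halfRange p → b ℕ.< p
    ∈-halfRange⇒<p b∈ =
      ℕₚ.≤-<-trans (ℕₚ.m≤n⇒m≤n+o half (proj₂ (∈-halfRange⁻ b∈))) half+half<p

    halfRange-square-injective : ∀ {b b′} → b ∈ halfRange p → b′ ∈ halfRange p →
                                 + b * + b ≈ + b′ * + b′ → b ≡ b′
    halfRange-square-injective {b} {b′} b∈ b′∈ (mk d) with x*y≈0⇒x≈0⊎y≈0 [b-b′][b+b′]≈0
      where
      difference-of-squares : ∀ x y → x * x - y * y ≡ (x - y) * (x + y)
      difference-of-squares = solve-∀
      [b-b′][b+b′]≈0 : (+ b - + b′) * (+ b + + b′) ≈ 0ℤ
      [b-b′][b+b′]≈0 = ∣⇒≈0 (subst (+ p ∣_) (difference-of-squares (+ b) (+ b′)) d)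
    ... | inj₁ b-b′≈0 = <p-≈-injective (∈-halfRange⇒<p b∈) (∈-halfRange⇒<p b′∈) (mk (≈0⇒∣ b-b′≈0))
    ... | inj₂ b+b′≈0 = ⊥-elim (0<n<p⇒n≉0 0<b+b′ b+b′<p (subst (_≈ 0ℤ) (sym (ℤₚ.pos-+ b b′)) b+b′≈0))
      where
      0<b+b′ : 0 ℕ.< b ℕ.+ b′
      0<b+b′ = ℕₚ.≤-trans (proj₁ (∈-halfRange⁻ b∈)) (ℕₚ.m≤m+n b b′)
      b+b′<p : b ℕ.+ b′ ℕ.< p
      b+b′<p = ℕₚ.≤-<-trans (ℕₚ.+-mono-≤ (proj₂ (∈-halfRange⁻ b∈)) (proj₂ (∈-halfRange⁻ b′∈))) half+half<p

    1+ab≡cd⇒ℤ : ∀ a b c d → 1 ℕ.+ a ℕ.* b ≡ c ℕ.* d → 1ℤ + + a * + b ≡ + c * + d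
    1+ab≡cd⇒ℤ a b c d eq = begin
      1ℤ + + a * + b     ≡⟨ cong (λ t → 1ℤ + t) (ℤₚ.pos-* a b) ⟨
      1ℤ + + (a ℕ.* b)   ≡⟨ ℤₚ.pos-+ 1 (a ℕ.* b) ⟨
      + (1 ℕ.+ a ℕ.* b)  ≡⟨ cong +_ eq ⟩
      + (c ℕ.* d)        ≡⟨ ℤₚ.pos-* c d ⟩
      + c * + d          ∎
      where open ≡-Reasoning

    inverse-exists : ∀ {b} → 0 ℕ.< b → b ℕ.< p → ∃ λ z → + b * z ≈ 1ℤ
    inverse-exists {b} 0<b b<p with coprime-Bézout (prime⇒coprime prime {{ℕ.>-nonZero 0<b}} b<p)
    ... | Bézout.-+ x y 1+xp≡yb = + y , mk (divides (+ x) (begin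
        + b * + y - 1ℤ            ≡⟨ cong (_- 1ℤ) (ℤₚ.*-comm (+ b) (+ y)) ⟩
        + y * + b - 1ℤ            ≡⟨ cong (_- 1ℤ) (1+ab≡cd⇒ℤ x p y b 1+xp≡yb) ⟨
        (1ℤ + + x * + p) - 1ℤ     ≡⟨ [1+a]-1≡a (+ x * + p) ⟩
        + x * + p                 ∎))
      where
      open ≡-Reasoning
      [1+a]-1≡a : ∀ a → (1ℤ + a) - 1ℤ ≡ a
      [1+a]-1≡a = solve-∀
    ... | Bézout.+- x y 1+yb≡xp = - + y , mk (divides (- + x) (begin
        + b * - + y - 1ℤ          ≡⟨ b[-y]-1≡-[1+yb] (+ b) (+ y) ⟩
        - (1ℤ + + y * + b)        ≡⟨ cong -_ (1+ab≡cd⇒ℤ y b x p 1+yb≡xp) ⟩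
        - (+ x * + p)             ≡⟨ ℤₚ.neg-distribˡ-* (+ x) (+ p) ⟩
        - + x * + p               ∎))
      where
      open ≡-Reasoning
      b[-y]-1≡-[1+yb] : ∀ b y → b * - y - 1ℤ ≡ - (1ℤ + y * b)
      b[-y]-1≡-[1+yb] = solve-∀

    %ℕ-≈ : ∀ z → + (z %ℕ p) ≈ z
    %ℕ-≈ z = mk (divides (- (z /ℕ p)) (begin
        + (z %ℕ p) - z                               ≡⟨ cong (λ t → + (z %ℕ p) - t) (a≡a%ℕn+[a/ℕn]*n z p) ⟩
        + (z %ℕ p) - (+ (z %ℕ p) + (z /ℕ p) * + p)   ≡⟨ r-[r+qp]≡[-q]p (+ (z %ℕ p)) (z /ℕ p) (+ p) ⟩
        - (z /ℕ p) * + p                             ∎))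
      where
      open ≡-Reasoning
      r-[r+qp]≡[-q]p : ∀ r q p → r - (r + q * p) ≡ - q * p
      r-[r+qp]≡[-q]p = solve-∀

    -- invMod searches {0, …, p − 1}; an inverse reduced mod p shows that the search succeeds.
    invMod-inverse : ∀ {b} → 0 ℕ.< b → b ℕ.< p → + b * + invMod p b ≈ 1ℤ
    invMod-inverse {b} 0<b b<p with inverse-exists 0<b b<p
    ... | z , bz≈1 with head-filterᵇ isInverse (∈-upTo⁺ (n%ℕd<d z p)) (dvdℤ-complete _ (divides-difference bz%p≈1))
      where
      isInverse : ℕ → Bool
      isInverse x = dvdℤ p (+ (b ℕ.* x) - + 1)
      bz%p≈1 : + (b ℕ.* (z %ℕ p)) ≈ 1ℤ
      bz%p≈1 = subst (_≈ 1ℤ) (sym (ℤₚ.pos-* b (z %ℕ p))) (≈-trans (*-cong (≈-refl {+ b}) (%ℕ-≈ z)) bz≈1)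
    ... | y , head≡y , by≈1 rewrite head≡y =
      subst (_≈ 1ℤ) (ℤₚ.pos-* b y) (mk (dvdℤ-sound (+ (b ℕ.* y) - 1ℤ) by≈1))

  module Polynomial where

    Poly : Set
    Poly = List ℤ

    infixl 6 _+ₚ_
    infixl 7 _*ₚ_ _·ₚ_

    ⟦_⟧ : Poly → ℤ → ℤ
    ⟦ [] ⟧     x = 0ℤ
    ⟦ a ∷ as ⟧ x = a + x * ⟦ as ⟧ x

    _+ₚ_ : Poly → Poly → Poly
    []       +ₚ bs       = bs
    (a ∷ as) +ₚ []       = a ∷ as
    (a ∷ as) +ₚ (b ∷ bs) = a + b ∷ as +ₚ bs

    _·ₚ_ : ℤ → Poly → Poly
    c ·ₚ as = map (c *_) as

    _*ₚ_ : Poly → Poly → Poly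
    []       *ₚ bs = []
    (a ∷ as) *ₚ bs = a ·ₚ bs +ₚ (0ℤ ∷ as *ₚ bs)

    ⟦+ₚ⟧ : ∀ as bs x → ⟦ as +ₚ bs ⟧ x ≡ ⟦ as ⟧ x + ⟦ bs ⟧ x
    ⟦+ₚ⟧ []       bs       x = sym (ℤₚ.+-identityˡ _)
    ⟦+ₚ⟧ (a ∷ as) []       x = sym (ℤₚ.+-identityʳ _)
    ⟦+ₚ⟧ (a ∷ as) (b ∷ bs) x = begin
        a + b + x * ⟦ as +ₚ bs ⟧ x                ≡⟨ cong (λ t → a + b + x * t) (⟦+ₚ⟧ as bs x) ⟩
        a + b + x * (⟦ as ⟧ x + ⟦ bs ⟧ x)         ≡⟨ distribute a b x (⟦ as ⟧ x) (⟦ bs ⟧ x) ⟩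
        a + x * ⟦ as ⟧ x + (b + x * ⟦ bs ⟧ x)     ∎
      where
      open ≡-Reasoning
      distribute : ∀ a b x A B → a + b + x * (A + B) ≡ a + x * A + (b + x * B)
      distribute = solve-∀

    ⟦·ₚ⟧ : ∀ c bs x → ⟦ c ·ₚ bs ⟧ x ≡ c * ⟦ bs ⟧ x
    ⟦·ₚ⟧ c []       x = sym (ℤₚ.*-zeroʳ c)
    ⟦·ₚ⟧ c (b ∷ bs) x = trans (cong (λ t → c * b + x * t) (⟦·ₚ⟧ c bs x)) (distribute c b x (⟦ bs ⟧ x))
      where
      distribute : ∀ c b x B → c * b + x * (c * B) ≡ c * (b + x * B)
      distribute = solve-∀

    ⟦*ₚ⟧ : ∀ as bs x → ⟦ as *ₚ bs ⟧ x ≡ ⟦ as ⟧ x * ⟦ bs ⟧ x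
    ⟦*ₚ⟧ []       bs x = sym (ℤₚ.*-zeroˡ (⟦ bs ⟧ x))
    ⟦*ₚ⟧ (a ∷ as) bs x = begin
        ⟦ a ·ₚ bs +ₚ (0ℤ ∷ as *ₚ bs) ⟧ x
          ≡⟨ ⟦+ₚ⟧ (a ·ₚ bs) (0ℤ ∷ as *ₚ bs) x ⟩
        ⟦ a ·ₚ bs ⟧ x + (0ℤ + x * ⟦ as *ₚ bs ⟧ x)
          ≡⟨ cong₂ (λ u v → u + (0ℤ + x * v)) (⟦·ₚ⟧ a bs x) (⟦*ₚ⟧ as bs x) ⟩
        a * ⟦ bs ⟧ x + (0ℤ + x * (⟦ as ⟧ x * ⟦ bs ⟧ x))
          ≡⟨ distribute a x (⟦ as ⟧ x) (⟦ bs ⟧ x) ⟩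
        (a + x * ⟦ as ⟧ x) * ⟦ bs ⟧ x
          ∎
      where
      open ≡-Reasoning
      distribute : ∀ a x A B → a * B + (0ℤ + x * (A * B)) ≡ (a + x * A) * B
      distribute = solve-∀

    Deg≤ : Poly → ℕ → Set
    Deg≤ as d = length as ℕ.≤ suc d

    deg-weaken : ∀ {as d e} → Deg≤ as d → d ℕ.≤ e → Deg≤ as e
    deg-weaken as≤d d≤e = ℕₚ.≤-trans as≤d (s≤s d≤e)

    length-+ₚ : ∀ as bs {n} → length as ℕ.≤ n → length bs ℕ.≤ n → length (as +ₚ bs) ℕ.≤ n
    length-+ₚ []       bs       _         bs≤n      = bs≤n
    length-+ₚ (a ∷ as) []       as≤n      _         = as≤n
    length-+ₚ (a ∷ as) (b ∷ bs) (s≤s as≤n) (s≤s bs≤n) = s≤s (length-+ₚ as bs as≤n bs≤n)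

    length-·ₚ : ∀ c bs → length (c ·ₚ bs) ≡ length bs
    length-·ₚ c bs = length-map (c *_) bs

    deg-+ₚ : ∀ {as bs d} → Deg≤ as d → Deg≤ bs d → Deg≤ (as +ₚ bs) d
    deg-+ₚ {as} {bs} = length-+ₚ as bs

    deg-·ₚ : ∀ {c bs d} → Deg≤ bs d → Deg≤ (c ·ₚ bs) d
    deg-·ₚ {c} {bs} = subst (ℕ._≤ _) (sym (length-·ₚ c bs))

    deg-*ₚ : ∀ as bs {d e} → Deg≤ as d → Deg≤ bs e → Deg≤ (as *ₚ bs) (d ℕ.+ e)
    deg-*ₚ []           bs         _           _     = z≤n
    deg-*ₚ (a ∷ [])     bs {d} {e} _           bs≤e  =
      length-+ₚ (a ·ₚ bs) (0ℤ ∷ []) (deg-·ₚ {a} {bs} (deg-weaken {bs} bs≤e (ℕₚ.m≤n+m e d))) (s≤s z≤n)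
    deg-*ₚ (a ∷ a′ ∷ as) bs {suc d} {e} (s≤s as≤d) bs≤e =
      length-+ₚ (a ·ₚ bs) (0ℤ ∷ (a′ ∷ as) *ₚ bs) (deg-·ₚ {a} {bs} (deg-weaken {bs} bs≤e (ℕₚ.m≤n+m e (suc d))))
        (s≤s (deg-*ₚ (a′ ∷ as) bs as≤d bs≤e))

    quotient : Poly → ℤ → Poly
    quotient []       r = []
    quotient (a ∷ as) r = as +ₚ r ·ₚ quotient as r

    length-quotient : ∀ as r → length (quotient as r) ℕ.≤ ℕ.pred (length as)
    length-quotient []       r = z≤n
    length-quotient (a ∷ as) r = length-+ₚ as (r ·ₚ quotient as r) ℕₚ.≤-refl
      (subst (ℕ._≤ _) (sym (length-·ₚ r (quotient as r))) (ℕₚ.≤-trans (length-quotient as r) ℕₚ.pred[n]≤n))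

    ⟦quotient⟧ : ∀ as r x → ⟦ as ⟧ x - ⟦ as ⟧ r ≡ (x - r) * ⟦ quotient as r ⟧ x
    ⟦quotient⟧ []       r x = sym (ℤₚ.*-zeroʳ (x - r))
    ⟦quotient⟧ (a ∷ as) r x = begin
        (a + x * A) - (a + r * B)      ≡⟨ regroup a x r A B ⟩
        (x - r) * A + r * (A - B)      ≡⟨ cong (λ t → (x - r) * A + r * t) (⟦quotient⟧ as r x) ⟩
        (x - r) * A + r * ((x - r) * Q) ≡⟨ factor x r A Q ⟩
        (x - r) * (A + r * Q)          ≡⟨ cong (λ t → (x - r) * (A + t)) (⟦·ₚ⟧ r (quotient as r) x) ⟨
        (x - r) * (A + ⟦ r ·ₚ quotient as r ⟧ x) ≡⟨ cong ((x - r) *_) (⟦+ₚ⟧ as (r ·ₚ quotient as r) x) ⟨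
        (x - r) * ⟦ quotient (a ∷ as) r ⟧ x     ∎
      where
      open ≡-Reasoning
      A B Q : ℤ
      A = ⟦ as ⟧ x
      B = ⟦ as ⟧ r
      Q = ⟦ quotient as r ⟧ x
      regroup : ∀ a x r A B → (a + x * A) - (a + r * B) ≡ (x - r) * A + r * (A - B)
      regroup = solve-∀
      factor : ∀ x r A Q → (x - r) * A + r * ((x - r) * Q) ≡ (x - r) * (A + r * Q)
      factor = solve-∀

  module RootBound {p : ℕ} (prime : Prime p) where
    open Congruence p
    open PrimeModulus prime
    open Polynomial

    private
      x-0≡x : ∀ x → x - 0ℤ ≡ x
      x-0≡x = solve-∀
      x-[x-y]≡y : ∀ x y → x - (x - y) ≡ y
      x-[x-y]≡y = solve-∀

      ≈-minus-≈0 : ∀ {x y} → y ≈ 0ℤ → x ≈ x - y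
      ≈-minus-≈0 {x} y≈0 = ≈-trans (≈-reflexive (sym (x-0≡x x))) (+-cong (≈-refl {x}) (-‿cong (≈-sym y≈0)))

    many-roots⇒≈0 : ∀ rs as → AllPairs _≉_ rs → All (λ r → ⟦ as ⟧ r ≈ 0ℤ) rs →
                    length as ℕ.≤ length rs → ∀ x → ⟦ as ⟧ x ≈ 0ℤ
    many-roots⇒≈0 []       []  _             _             _  x = ≈-refl
    many-roots⇒≈0 (r ∷ rs) as  (r≉rs ∷ sep) (as[r]≈0 ∷ roots) as≤ x = begin
        ⟦ as ⟧ x                      ≈⟨ ≈-minus-≈0 as[r]≈0 ⟩
        ⟦ as ⟧ x - ⟦ as ⟧ r           ≡⟨ ⟦quotient⟧ as r x ⟩
        (x - r) * ⟦ quotient as r ⟧ x ≈⟨ *-cong (≈-refl {x - r}) (many-roots⇒≈0 rs (quotient as r) sep q-roots q≤ x) ⟩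
        (x - r) * 0ℤ                  ≡⟨ ℤₚ.*-zeroʳ (x - r) ⟩
        0ℤ                            ∎
      where
      open import Relation.Binary.Reasoning.Setoid ≈-setoid
      q≤ : length (quotient as r) ℕ.≤ length rs
      q≤ = ℕₚ.≤-trans (length-quotient as r) (ℕₚ.pred-mono-≤ as≤)
      q-root : ∀ {r′} → r ≉ r′ × ⟦ as ⟧ r′ ≈ 0ℤ → ⟦ quotient as r ⟧ r′ ≈ 0ℤ
      q-root {r′} (r≉r′ , as[r′]≈0) with x*y≈0⇒x≈0⊎y≈0 [r′-r]q[r′]≈0
        where
        [r′-r]q[r′]≈0 : (r′ - r) * ⟦ quotient as r ⟧ r′ ≈ 0ℤ
        [r′-r]q[r′]≈0 = ≈-trans (≈-reflexive (sym (⟦quotient⟧ as r r′)))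
                          (+-cong as[r′]≈0 (-‿cong as[r]≈0))
      ... | inj₂ q[r′]≈0 = q[r′]≈0
      ... | inj₁ r′-r≈0  = ⊥-elim (r≉r′ (≈-sym (≈-trans (≈-minus-≈0 r′-r≈0) (≈-reflexive (x-[x-y]≡y r′ r)))))
      q-roots : All (λ r′ → ⟦ quotient as r ⟧ r′ ≈ 0ℤ) rs
      q-roots = All.zipWith q-root (r≉rs , roots)

    roots-bound : ∀ {rs as x} → AllPairs _≉_ rs → All (λ r → ⟦ as ⟧ r ≈ 0ℤ) rs → ⟦ as ⟧ x ≉ 0ℤ →
                  length rs ℕ.< length as
    roots-bound {rs} {as} {x} sep roots as[x]≉0 =
      ℕₚ.≰⇒> (λ as≤rs → as[x]≉0 (many-roots⇒≈0 rs as sep roots as≤rs x))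

  module Tower where
    open Polynomial

    -- (a , b) : Tower (t ∷ ts) stands for a + β_t b, where β_t is a formal square root of c + t
    -- and c is the variable of the coefficient polynomials.
    Tower : List ℕ → Set
    Tower []       = Poly
    Tower (t ∷ ts) = Tower ts × Tower ts

    X+ : ℕ → Poly
    X+ t = + t ∷ 1ℤ ∷ []

    0ᵀ : ∀ ts → Tower ts
    0ᵀ []       = []
    0ᵀ (t ∷ ts) = 0ᵀ ts , 0ᵀ ts

    embed : ∀ ts → Poly → Tower ts
    embed []       q = q
    embed (t ∷ ts) q = embed ts q , 0ᵀ ts

    add : ∀ ts → Tower ts → Tower ts → Tower ts
    add []       x       y         = x +ₚ y
    add (t ∷ ts) (a , b) (a′ , b′) = add ts a a′ , add ts b b′

    scale : ∀ ts → Poly → Tower ts → Tower ts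
    scale []       q x       = q *ₚ x
    scale (t ∷ ts) q (a , b) = scale ts q a , scale ts q b

    mul : ∀ ts → Tower ts → Tower ts → Tower ts
    mul []       x       y         = x *ₚ y
    mul (t ∷ ts) (a , b) (a′ , b′) =
      add ts (mul ts a a′) (scale ts (X+ t) (mul ts b b′)) , add ts (mul ts a b′) (mul ts b a′)

    -- The norm (a + β_t b)(a − β_t b) = a² − (c + t) b² eliminates β_t.
    normTop : ∀ t ts → Tower (t ∷ ts) → Tower ts
    normTop t ts (a , b) = add ts (mul ts a a) (scale ts (- 1ℤ ·ₚ X+ t) (mul ts b b))

    Πβ : ∀ ts → Tower ts
    Πβ []       = 1ℤ ∷ []
    Πβ (t ∷ ts) = 0ᵀ ts , Πβ ts

    ∏X+ : List ℕ → Poly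
    ∏X+ []       = 1ℤ ∷ []
    ∏X+ (t ∷ ts) = X+ t *ₚ ∏X+ ts

    norm : ∀ ts → Tower ts → Poly
    norm []       x = x
    norm (t ∷ ts) x = norm ts (normTop t ts x)

    DegT : ∀ ts → Tower ts → ℕ → Set
    DegT []       x       d = Deg≤ x d
    DegT (t ∷ ts) (a , b) d = DegT ts a d × DegT ts b d

    degT-weaken : ∀ ts {x d e} → DegT ts x d → d ℕ.≤ e → DegT ts x e
    degT-weaken []       {x} x≤d       d≤e = deg-weaken {x} x≤d d≤e
    degT-weaken (t ∷ ts) (a≤d , b≤d) d≤e = degT-weaken ts a≤d d≤e , degT-weaken ts b≤d d≤e

    degT-0ᵀ : ∀ ts {d} → DegT ts (0ᵀ ts) d
    degT-0ᵀ []       = z≤n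
    degT-0ᵀ (t ∷ ts) = degT-0ᵀ ts , degT-0ᵀ ts

    degT-add : ∀ ts {x y d} → DegT ts x d → DegT ts y d → DegT ts (add ts x y) d
    degT-add []       {x} {y} x≤d y≤d = deg-+ₚ {x} {y} x≤d y≤d
    degT-add (t ∷ ts) (a≤d , b≤d) (a′≤d , b′≤d) = degT-add ts a≤d a′≤d , degT-add ts b≤d b′≤d

    degT-scale : ∀ ts q {x e d f} → Deg≤ q e → DegT ts x d → e ℕ.+ d ℕ.≤ f → DegT ts (scale ts q x) f
    degT-scale []       q {x} q≤e x≤d e+d≤f = deg-weaken {q *ₚ x} (deg-*ₚ q x q≤e x≤d) e+d≤f
    degT-scale (t ∷ ts) q q≤e (a≤d , b≤d) e+d≤f = degT-scale ts q q≤e a≤d e+d≤f , degT-scale ts q q≤e b≤d e+d≤f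

    degT-mul : ∀ ts {x y d e f} → DegT ts x d → DegT ts y e → d ℕ.+ e ℕ.+ length ts ℕ.≤ f →
               DegT ts (mul ts x y) f
    degT-mul []       {x} {y} {d} {e} x≤d y≤e d+e≤f =
      deg-weaken {x *ₚ y} (deg-*ₚ x y x≤d y≤e) (ℕₚ.≤-trans (ℕₚ.m≤m+n (d ℕ.+ e) 0) d+e≤f)
    degT-mul (t ∷ ts) {d = d} {e} {f} (a≤d , b≤d) (a′≤e , b′≤e) d+e+1+m≤f =
      degT-add ts (degT-mul ts a≤d a′≤e d+e+m≤f)
                  (degT-scale ts (X+ t) {e = 1} (s≤s (s≤s z≤n)) (degT-mul ts b≤d b′≤e ℕₚ.≤-refl) 1+d+e+m≤f) ,
      degT-add ts (degT-mul ts a≤d b′≤e d+e+m≤f) (degT-mul ts b≤d a′≤e d+e+m≤f)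
      where
      d+e+m≤f : d ℕ.+ e ℕ.+ length ts ℕ.≤ f
      d+e+m≤f = ℕₚ.≤-trans (ℕₚ.+-monoʳ-≤ (d ℕ.+ e) (ℕₚ.n≤1+n (length ts))) d+e+1+m≤f
      1+d+e+m≤f : 1 ℕ.+ (d ℕ.+ e ℕ.+ length ts) ℕ.≤ f
      1+d+e+m≤f = subst (ℕ._≤ f) (ℕₚ.+-suc (d ℕ.+ e) (length ts)) d+e+1+m≤f

    degT-normTop : ∀ t ts {x d} → DegT (t ∷ ts) x d → DegT ts (normTop t ts x) (d ℕ.+ d ℕ.+ suc (length ts))
    degT-normTop t ts {d = d} (a≤d , b≤d) =
      degT-add ts (degT-mul ts a≤d a≤d (ℕₚ.+-monoʳ-≤ (d ℕ.+ d) (ℕₚ.n≤1+n (length ts))))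
        (degT-scale ts (- 1ℤ ·ₚ X+ t) {e = 1} (s≤s (s≤s z≤n)) (degT-mul ts b≤d b≤d ℕₚ.≤-refl)
          (ℕₚ.≤-reflexive (sym (ℕₚ.+-suc (d ℕ.+ d) (length ts)))))

    normDegree : ℕ → ℕ → ℕ
    normDegree zero    d = d
    normDegree (suc m) d = normDegree m (d ℕ.+ d ℕ.+ suc m)

    deg-norm : ∀ ts {x d} → DegT ts x d → Deg≤ (norm ts x) (normDegree (length ts) d)
    deg-norm []       x≤d = x≤d
    deg-norm (t ∷ ts) x≤d = deg-norm ts (degT-normTop t ts x≤d)

    normDegree≤ : ∀ m d → normDegree m d ℕ.≤ 2 ℕ.^ m ℕ.* (d ℕ.+ m)
    normDegree≤ zero    d = ℕₚ.≤-reflexive (sym (trans (ℕₚ.+-identityʳ (d ℕ.+ 0)) (ℕₚ.+-identityʳ d)))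
    normDegree≤ (suc m) d = begin
        normDegree m (d ℕ.+ d ℕ.+ suc m)                  ≤⟨ normDegree≤ m (d ℕ.+ d ℕ.+ suc m) ⟩
        2 ℕ.^ m ℕ.* (d ℕ.+ d ℕ.+ suc m ℕ.+ m)             ≤⟨ ℕₚ.*-monoʳ-≤ (2 ℕ.^ m) (ℕₚ.n≤1+n _) ⟩
        2 ℕ.^ m ℕ.* suc (d ℕ.+ d ℕ.+ suc m ℕ.+ m)         ≡⟨ regroup (2 ℕ.^ m) d m ⟩
        2 ℕ.^ suc m ℕ.* (d ℕ.+ suc m)                     ∎
      where
      open ℕₚ.≤-Reasoning
      regroup : ∀ P d m → P ℕ.* suc (d ℕ.+ d ℕ.+ suc m ℕ.+ m) ≡ (2 ℕ.* P) ℕ.* (d ℕ.+ suc m)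
      regroup = ℕ-solve-∀

    evalᵀ : ∀ ts → Tower ts → ℤ → List ℕ → ℤ
    evalᵀ []       x       c bs       = ⟦ x ⟧ c
    evalᵀ (t ∷ ts) (a , b) c []       = evalᵀ ts a c []
    evalᵀ (t ∷ ts) (a , b) c (β ∷ bs) = evalᵀ ts a c bs + + β * evalᵀ ts b c bs

    evalᵀ-0ᵀ : ∀ ts c bs → evalᵀ ts (0ᵀ ts) c bs ≡ 0ℤ
    evalᵀ-0ᵀ []       c bs       = refl
    evalᵀ-0ᵀ (t ∷ ts) c []       = evalᵀ-0ᵀ ts c []
    evalᵀ-0ᵀ (t ∷ ts) c (β ∷ bs) = begin
        evalᵀ ts (0ᵀ ts) c bs + + β * evalᵀ ts (0ᵀ ts) c bs
          ≡⟨ cong₂ (λ u v → u + + β * v) (evalᵀ-0ᵀ ts c bs) (evalᵀ-0ᵀ ts c bs) ⟩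
        0ℤ + + β * 0ℤ
          ≡⟨ cong (λ v → 0ℤ + v) (ℤₚ.*-zeroʳ (+ β)) ⟩
        0ℤ
          ∎
      where open ≡-Reasoning

    evalᵀ-add : ∀ ts x y c bs → evalᵀ ts (add ts x y) c bs ≡ evalᵀ ts x c bs + evalᵀ ts y c bs
    evalᵀ-add []       x       y         c bs       = ⟦+ₚ⟧ x y c
    evalᵀ-add (t ∷ ts) (a , b) (a′ , b′) c []       = evalᵀ-add ts a a′ c []
    evalᵀ-add (t ∷ ts) (a , b) (a′ , b′) c (β ∷ bs) =
      trans (cong₂ (λ u v → u + + β * v) (evalᵀ-add ts a a′ c bs) (evalᵀ-add ts b b′ c bs))
            (distribute (evalᵀ ts a c bs) (evalᵀ ts a′ c bs) (evalᵀ ts b c bs) (evalᵀ ts b′ c bs) (+ β))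
      where
      distribute : ∀ A A′ B B′ β → A + A′ + β * (B + B′) ≡ A + β * B + (A′ + β * B′)
      distribute = solve-∀

    evalᵀ-scale : ∀ ts q x c bs → evalᵀ ts (scale ts q x) c bs ≡ ⟦ q ⟧ c * evalᵀ ts x c bs
    evalᵀ-scale []       q x       c bs       = ⟦*ₚ⟧ q x c
    evalᵀ-scale (t ∷ ts) q (a , b) c []       = evalᵀ-scale ts q a c []
    evalᵀ-scale (t ∷ ts) q (a , b) c (β ∷ bs) =
      trans (cong₂ (λ u v → u + + β * v) (evalᵀ-scale ts q a c bs) (evalᵀ-scale ts q b c bs))
            (distribute (⟦ q ⟧ c) (evalᵀ ts a c bs) (evalᵀ ts b c bs) (+ β))
      where
      distribute : ∀ Q A B β → Q * A + β * (Q * B) ≡ Q * (A + β * B)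
      distribute = solve-∀

    ⟦X+⟧ : ∀ t c → ⟦ X+ t ⟧ c ≡ c + + t
    ⟦X+⟧ t c = linear (+ t) c
      where
      linear : ∀ t c → t + c * (1ℤ + c * 0ℤ) ≡ c + t
      linear = solve-∀

  module TowerRoots (p : ℕ) where
    open Congruence p
    open Polynomial
    open Tower
    open import Relation.Binary.Reasoning.Setoid ≈-setoid

    SquareRoots : ℤ → List ℕ → List ℕ → Set
    SquareRoots c = Pointwise (λ t β → + β * + β ≈ c + + t)

    evalᵀ-mul : ∀ ts x y c {bs} → SquareRoots c ts bs →
                evalᵀ ts (mul ts x y) c bs ≈ evalᵀ ts x c bs * evalᵀ ts y c bs
    evalᵀ-mul []       x       y         c []                 = ≈-reflexive (⟦*ₚ⟧ x y c)
    evalᵀ-mul (t ∷ ts) (a , b) (a′ , b′) c {β ∷ bs} (β²≈c+t ∷ roots) = begin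
        evalᵀ ts (add ts (mul ts a a′) (scale ts (X+ t) (mul ts b b′))) c bs
          + + β * evalᵀ ts (add ts (mul ts a b′) (mul ts b a′)) c bs
      ≡⟨ cong₂ (λ u v → u + + β * v)
           (trans (evalᵀ-add ts _ _ c bs) (cong (λ v → evalᵀ ts (mul ts a a′) c bs + v) (evalᵀ-scale ts (X+ t) _ c bs)))
           (evalᵀ-add ts _ _ c bs) ⟩
        (evalᵀ ts (mul ts a a′) c bs + ⟦ X+ t ⟧ c * evalᵀ ts (mul ts b b′) c bs)
          + + β * (evalᵀ ts (mul ts a b′) c bs + evalᵀ ts (mul ts b a′) c bs)
      ≈⟨ +-cong (+-cong (evalᵀ-mul ts a a′ c roots)
                        (*-cong (≈-trans (≈-reflexive (⟦X+⟧ t c)) (≈-sym β²≈c+t)) (evalᵀ-mul ts b b′ c roots)))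
                (*-cong (≈-refl {+ β}) (+-cong (evalᵀ-mul ts a b′ c roots) (evalᵀ-mul ts b a′ c roots))) ⟩
        (A * A′ + (+ β * + β) * (B * B′)) + + β * (A * B′ + B * A′)
      ≡⟨ expand A B A′ B′ (+ β) ⟩
        (A + + β * B) * (A′ + + β * B′)
      ∎
      where
      A B A′ B′ : ℤ
      A = evalᵀ ts a c bs
      B = evalᵀ ts b c bs
      A′ = evalᵀ ts a′ c bs
      B′ = evalᵀ ts b′ c bs
      expand : ∀ A B A′ B′ β → A * A′ + β * β * (B * B′) + β * (A * B′ + B * A′) ≡ (A + β * B) * (A′ + β * B′)
      expand = solve-∀

    evalᵀ-normTop : ∀ t ts a b c {β bs} → SquareRoots c (t ∷ ts) (β ∷ bs) →
                    evalᵀ ts (normTop t ts (a , b)) c bs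
                      ≈ evalᵀ (t ∷ ts) (a , b) c (β ∷ bs) * (evalᵀ ts a c bs - + β * evalᵀ ts b c bs)
    evalᵀ-normTop t ts a b c {β} {bs} (β²≈c+t ∷ roots) = begin
        evalᵀ ts (add ts (mul ts a a) (scale ts (- 1ℤ ·ₚ X+ t) (mul ts b b))) c bs
      ≡⟨ trans (evalᵀ-add ts _ _ c bs) (cong (λ v → evalᵀ ts (mul ts a a) c bs + v) (evalᵀ-scale ts _ _ c bs)) ⟩
        evalᵀ ts (mul ts a a) c bs + ⟦ - 1ℤ ·ₚ X+ t ⟧ c * evalᵀ ts (mul ts b b) c bs
      ≡⟨ cong (λ v → evalᵀ ts (mul ts a a) c bs + v * evalᵀ ts (mul ts b b) c bs)
              (trans (⟦·ₚ⟧ (- 1ℤ) (X+ t) c) (cong (- 1ℤ *_) (⟦X+⟧ t c))) ⟩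
        evalᵀ ts (mul ts a a) c bs + - 1ℤ * (c + + t) * evalᵀ ts (mul ts b b) c bs
      ≈⟨ +-cong (evalᵀ-mul ts a a c roots)
                (*-cong (*-cong (≈-refl { - 1ℤ}) (≈-sym β²≈c+t)) (evalᵀ-mul ts b b c roots)) ⟩
        A * A + - 1ℤ * (+ β * + β) * (B * B)
      ≡⟨ difference-of-squares A B (+ β) ⟩
        (A + + β * B) * (A - + β * B)
      ∎
      where
      A B : ℤ
      A = evalᵀ ts a c bs
      B = evalᵀ ts b c bs
      difference-of-squares : ∀ A B β → A * A + - 1ℤ * (β * β) * (B * B) ≡ (A + β * B) * (A - β * B)
      difference-of-squares = solve-∀

    norm-root : ∀ ts x c {bs} → SquareRoots c ts bs → evalᵀ ts x c bs ≈ 0ℤ → ⟦ norm ts x ⟧ c ≈ 0ℤ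
    norm-root []       x       c []                     x≈0 = x≈0
    norm-root (t ∷ ts) (a , b) c {β ∷ bs} (β² ∷ roots) x≈0 =
      norm-root ts (normTop t ts (a , b)) c roots (begin
        evalᵀ ts (normTop t ts (a , b)) c bs  ≈⟨ evalᵀ-normTop t ts a b c {β} (β² ∷ roots) ⟩
        evalᵀ (t ∷ ts) (a , b) c (β ∷ bs) * C ≈⟨ *-cong x≈0 (≈-refl {C}) ⟩
        0ℤ * C                                ≡⟨ ℤₚ.*-zeroˡ C ⟩
        0ℤ                                    ∎)
      where
      C : ℤ
      C = evalᵀ ts a c bs - + β * evalᵀ ts b c bs

  module Specialisation (p : ℕ) (c₀ : ℤ) where
    open Congruence p
    open Polynomial
    open Tower

    -- The representation of towers is not canonical; agreement of all coefficients at c₀ mod p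
    -- is a congruence for the tower operations, so the norm can be computed after specialising.
    Agree : ∀ ts → Tower ts → Tower ts → Set
    Agree []       q       q′        = ⟦ q ⟧ c₀ ≈ ⟦ q′ ⟧ c₀
    Agree (t ∷ ts) (a , b) (a′ , b′) = Agree ts a a′ × Agree ts b b′

    agree-refl : ∀ ts {x} → Agree ts x x
    agree-refl []       = ≈-refl
    agree-refl (t ∷ ts) = agree-refl ts , agree-refl ts

    agree-trans : ∀ ts {x y z} → Agree ts x y → Agree ts y z → Agree ts x z
    agree-trans []       x~y             y~z             = ≈-trans x~y y~z
    agree-trans (t ∷ ts) (a~a′ , b~b′) (a′~a″ , b′~b″) = agree-trans ts a~a′ a′~a″ , agree-trans ts b~b′ b′~b″

    agree-add : ∀ ts {x x′ y y′} → Agree ts x x′ → Agree ts y y′ → Agree ts (add ts x y) (add ts x′ y′)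
    agree-add []       {x} {x′} {y} {y′} x~x′ y~y′ =
      ≈-trans (≈-reflexive (⟦+ₚ⟧ x y c₀)) (≈-trans (+-cong x~x′ y~y′) (≈-reflexive (sym (⟦+ₚ⟧ x′ y′ c₀))))
    agree-add (t ∷ ts) (a~ , b~) (a′~ , b′~) = agree-add ts a~ a′~ , agree-add ts b~ b′~

    agree-scale : ∀ ts {q q′ x x′} → ⟦ q ⟧ c₀ ≈ ⟦ q′ ⟧ c₀ → Agree ts x x′ →
                  Agree ts (scale ts q x) (scale ts q′ x′)
    agree-scale []       {q} {q′} {x} {x′} q~q′ x~x′ =
      ≈-trans (≈-reflexive (⟦*ₚ⟧ q x c₀)) (≈-trans (*-cong q~q′ x~x′) (≈-reflexive (sym (⟦*ₚ⟧ q′ x′ c₀))))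
    agree-scale (t ∷ ts) q~q′ (a~ , b~) = agree-scale ts q~q′ a~ , agree-scale ts q~q′ b~

    agree-scaleʳ : ∀ ts q {x x′} → Agree ts x x′ → Agree ts (scale ts q x) (scale ts q x′)
    agree-scaleʳ ts q = agree-scale ts {q} {q} ≈-refl

    agree-mul : ∀ ts {x x′ y y′} → Agree ts x x′ → Agree ts y y′ → Agree ts (mul ts x y) (mul ts x′ y′)
    agree-mul []       {x} {x′} {y} {y′} x~x′ y~y′ =
      ≈-trans (≈-reflexive (⟦*ₚ⟧ x y c₀)) (≈-trans (*-cong x~x′ y~y′) (≈-reflexive (sym (⟦*ₚ⟧ x′ y′ c₀))))
    agree-mul (t ∷ ts) (a~ , b~) (a′~ , b′~) =
      agree-add ts (agree-mul ts a~ a′~) (agree-scaleʳ ts (X+ t) (agree-mul ts b~ b′~)) ,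
      agree-add ts (agree-mul ts a~ b′~) (agree-mul ts b~ a′~)

    agree-normTop : ∀ t ts {x x′} → Agree (t ∷ ts) x x′ → Agree ts (normTop t ts x) (normTop t ts x′)
    agree-normTop t ts (a~ , b~) = agree-add ts (agree-mul ts a~ a~) (agree-scaleʳ ts _ (agree-mul ts b~ b~))

    agree-norm : ∀ ts {x x′} → Agree ts x x′ → ⟦ norm ts x ⟧ c₀ ≈ ⟦ norm ts x′ ⟧ c₀
    agree-norm []       x~x′ = x~x′
    agree-norm (t ∷ ts) x~x′ = agree-norm ts (agree-normTop t ts x~x′)

    scale-0ᵀ : ∀ ts q → Agree ts (scale ts q (0ᵀ ts)) (0ᵀ ts)
    scale-0ᵀ []       q = ≈-reflexive (trans (⟦*ₚ⟧ q [] c₀) (ℤₚ.*-zeroʳ (⟦ q ⟧ c₀)))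
    scale-0ᵀ (t ∷ ts) q = scale-0ᵀ ts q , scale-0ᵀ ts q

    scale-by-≈0 : ∀ ts q x → ⟦ q ⟧ c₀ ≈ 0ℤ → Agree ts (scale ts q x) (0ᵀ ts)
    scale-by-≈0 []       q x       q≈0 =
      ≈-trans (≈-reflexive (⟦*ₚ⟧ q x c₀))
              (≈-trans (*-cong q≈0 (≈-refl {⟦ x ⟧ c₀})) (≈-reflexive (ℤₚ.*-zeroˡ (⟦ x ⟧ c₀))))
    scale-by-≈0 (t ∷ ts) q (a , b) q≈0 = scale-by-≈0 ts q a q≈0 , scale-by-≈0 ts q b q≈0

    add-0ᵀʳ : ∀ ts x → Agree ts (add ts x (0ᵀ ts)) x
    add-0ᵀʳ []       x       = ≈-reflexive (trans (⟦+ₚ⟧ x [] c₀) (ℤₚ.+-identityʳ (⟦ x ⟧ c₀)))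
    add-0ᵀʳ (t ∷ ts) (a , b) = add-0ᵀʳ ts a , add-0ᵀʳ ts b

    add-0ᵀˡ : ∀ ts x → Agree ts (add ts (0ᵀ ts) x) x
    add-0ᵀˡ []       x       = ≈-refl
    add-0ᵀˡ (t ∷ ts) (a , b) = add-0ᵀˡ ts a , add-0ᵀˡ ts b

    mul-0ᵀˡ : ∀ ts x → Agree ts (mul ts (0ᵀ ts) x) (0ᵀ ts)
    mul-0ᵀˡ []       x       = ≈-refl
    mul-0ᵀˡ (t ∷ ts) (a , b) =
      agree-trans ts (agree-add ts (mul-0ᵀˡ ts a)
                                   (agree-trans ts (agree-scaleʳ ts (X+ t) (mul-0ᵀˡ ts b)) (scale-0ᵀ ts (X+ t))))
                     (add-0ᵀˡ ts (0ᵀ ts)) ,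
      agree-trans ts (agree-add ts (mul-0ᵀˡ ts b) (mul-0ᵀˡ ts a)) (add-0ᵀˡ ts (0ᵀ ts))

    mul-0ᵀʳ : ∀ ts x → Agree ts (mul ts x (0ᵀ ts)) (0ᵀ ts)
    mul-0ᵀʳ []       x       = ≈-reflexive (trans (⟦*ₚ⟧ x [] c₀) (ℤₚ.*-zeroʳ (⟦ x ⟧ c₀)))
    mul-0ᵀʳ (t ∷ ts) (a , b) =
      agree-trans ts (agree-add ts (mul-0ᵀʳ ts a)
                                   (agree-trans ts (agree-scaleʳ ts (X+ t) (mul-0ᵀʳ ts b)) (scale-0ᵀ ts (X+ t))))
                     (add-0ᵀˡ ts (0ᵀ ts)) ,
      agree-trans ts (agree-add ts (mul-0ᵀʳ ts a) (mul-0ᵀʳ ts b)) (add-0ᵀˡ ts (0ᵀ ts))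

    embed-agree : ∀ ts {q q′} → ⟦ q ⟧ c₀ ≈ ⟦ q′ ⟧ c₀ → Agree ts (embed ts q) (embed ts q′)
    embed-agree []       q~q′ = q~q′
    embed-agree (t ∷ ts) q~q′ = embed-agree ts q~q′ , agree-refl ts

    scale-embed : ∀ ts q r → Agree ts (scale ts q (embed ts r)) (embed ts (q *ₚ r))
    scale-embed []       q r = ≈-refl
    scale-embed (t ∷ ts) q r = scale-embed ts q r , scale-0ᵀ ts q

    mul-embed : ∀ ts q r → Agree ts (mul ts (embed ts q) (embed ts r)) (embed ts (q *ₚ r))
    mul-embed []       q r = ≈-refl
    mul-embed (t ∷ ts) q r =
      agree-trans ts (agree-add ts (mul-embed ts q r)
                                   (agree-trans ts (agree-scaleʳ ts (X+ t) (mul-0ᵀˡ ts (0ᵀ ts))) (scale-0ᵀ ts (X+ t))))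
                     (add-0ᵀʳ ts _) ,
      agree-trans ts (agree-add ts (mul-0ᵀʳ ts (embed ts q)) (mul-0ᵀˡ ts (embed ts r))) (add-0ᵀˡ ts (0ᵀ ts))

    normTop-embed : ∀ t ts q → Agree ts (normTop t ts (embed (t ∷ ts) q)) (embed ts (q *ₚ q))
    normTop-embed t ts q =
      agree-trans ts (agree-add ts (mul-embed ts q q)
                                   (agree-trans ts (agree-scaleʳ ts (- 1ℤ ·ₚ X+ t) (mul-0ᵀˡ ts (0ᵀ ts))) (scale-0ᵀ ts _)))
                     (add-0ᵀʳ ts _)

    repeatedSquare : ℕ → Poly → Poly
    repeatedSquare zero    q = q
    repeatedSquare (suc m) q = repeatedSquare m (q *ₚ q)

    norm-embed : ∀ ts q → ⟦ norm ts (embed ts q) ⟧ c₀ ≈ ⟦ repeatedSquare (length ts) q ⟧ c₀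
    norm-embed []       q = ≈-refl
    norm-embed (t ∷ ts) q = ≈-trans (agree-norm ts (normTop-embed t ts q)) (norm-embed ts (q *ₚ q))

    square-scaled-Πβ : ∀ ts a → Agree ts (mul ts (scale ts a (Πβ ts)) (scale ts a (Πβ ts)))
                                         (embed ts (a *ₚ a *ₚ ∏X+ ts))
    square-scaled-Πβ []       a = ≈-reflexive (begin
        ⟦ (a *ₚ (1ℤ ∷ [])) *ₚ (a *ₚ (1ℤ ∷ [])) ⟧ c₀        ≡⟨ ⟦*ₚ⟧ (a *ₚ (1ℤ ∷ [])) (a *ₚ (1ℤ ∷ [])) c₀ ⟩
        ⟦ a *ₚ (1ℤ ∷ []) ⟧ c₀ * ⟦ a *ₚ (1ℤ ∷ []) ⟧ c₀     ≡⟨ cong₂ _*_ (⟦*ₚ⟧ a (1ℤ ∷ []) c₀) (⟦*ₚ⟧ a (1ℤ ∷ []) c₀) ⟩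
        ⟦ a ⟧ c₀ * ⟦ 1ℤ ∷ [] ⟧ c₀ * (⟦ a ⟧ c₀ * ⟦ 1ℤ ∷ [] ⟧ c₀) ≡⟨ regroup (⟦ a ⟧ c₀) c₀ ⟩
        ⟦ a ⟧ c₀ * ⟦ a ⟧ c₀ * ⟦ 1ℤ ∷ [] ⟧ c₀             ≡⟨ cong (_* ⟦ 1ℤ ∷ [] ⟧ c₀) (⟦*ₚ⟧ a a c₀) ⟨
        ⟦ a *ₚ a ⟧ c₀ * ⟦ 1ℤ ∷ [] ⟧ c₀                    ≡⟨ ⟦*ₚ⟧ (a *ₚ a) (1ℤ ∷ []) c₀ ⟨
        ⟦ a *ₚ a *ₚ (1ℤ ∷ []) ⟧ c₀                        ∎)
      where
      open ≡-Reasoning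
      regroup : ∀ x c → x * (1ℤ + c * 0ℤ) * (x * (1ℤ + c * 0ℤ)) ≡ x * x * (1ℤ + c * 0ℤ)
      regroup = solve-∀
    square-scaled-Πβ (t ∷ ts) a =
      agree-trans ts (agree-add ts (agree-trans ts (agree-mul ts (scale-0ᵀ ts a) (scale-0ᵀ ts a)) (mul-0ᵀˡ ts (0ᵀ ts)))
                                   (agree-trans ts (agree-scaleʳ ts (X+ t) (square-scaled-Πβ ts a)) (scale-embed ts (X+ t) _)))
                     (agree-trans ts (add-0ᵀˡ ts _) (embed-agree ts (≈-reflexive (commute (X+ t) (a *ₚ a) (∏X+ ts))))) ,
      agree-trans ts (agree-add ts (agree-trans ts (agree-mul ts (scale-0ᵀ ts a) (agree-refl ts)) (mul-0ᵀˡ ts _))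
                                   (agree-trans ts (agree-mul ts (agree-refl ts) (scale-0ᵀ ts a)) (mul-0ᵀʳ ts _)))
                     (add-0ᵀˡ ts (0ᵀ ts))
      where
      commute : ∀ u q r → ⟦ u *ₚ (q *ₚ r) ⟧ c₀ ≡ ⟦ q *ₚ (u *ₚ r) ⟧ c₀
      commute u q r = begin
          ⟦ u *ₚ (q *ₚ r) ⟧ c₀                ≡⟨ ⟦*ₚ⟧ u (q *ₚ r) c₀ ⟩
          ⟦ u ⟧ c₀ * ⟦ q *ₚ r ⟧ c₀            ≡⟨ cong (⟦ u ⟧ c₀ *_) (⟦*ₚ⟧ q r c₀) ⟩
          ⟦ u ⟧ c₀ * (⟦ q ⟧ c₀ * ⟦ r ⟧ c₀)     ≡⟨ swap (⟦ u ⟧ c₀) (⟦ q ⟧ c₀) (⟦ r ⟧ c₀) ⟩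
          ⟦ q ⟧ c₀ * (⟦ u ⟧ c₀ * ⟦ r ⟧ c₀)     ≡⟨ cong (⟦ q ⟧ c₀ *_) (⟦*ₚ⟧ u r c₀) ⟨
          ⟦ q ⟧ c₀ * ⟦ u *ₚ r ⟧ c₀            ≡⟨ ⟦*ₚ⟧ q (u *ₚ r) c₀ ⟨
          ⟦ q *ₚ (u *ₚ r) ⟧ c₀                ∎
        where
        open ≡-Reasoning
        swap : ∀ x y z → x * (y * z) ≡ y * (x * z)
        swap = solve-∀

  module Numerator (p : ℕ) (ℓ : ℕ → ℤ) (w : ℤ) where
    open Congruence p
    open Polynomial
    open Tower
    open TowerRoots p

    -- Π_t β_t · (w − Σ_t ℓ_t / β_t), with β_t⁻¹ Π_σ β_σ written as Π_{σ ≠ t} β_σ.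
    numerator : ∀ ts → Tower ts
    numerator []       = w ∷ []
    numerator (t ∷ ts) = scale ts (- ℓ t ∷ []) (Πβ ts) , numerator ts

    degT-Πβ : ∀ ts → DegT ts (Πβ ts) 0
    degT-Πβ []       = s≤s z≤n
    degT-Πβ (t ∷ ts) = degT-0ᵀ ts , degT-Πβ ts

    degT-numerator : ∀ ts → DegT ts (numerator ts) 0
    degT-numerator []       = s≤s z≤n
    degT-numerator (t ∷ ts) = degT-scale ts (- ℓ t ∷ []) {e = 0} (s≤s z≤n) (degT-Πβ ts) z≤n , degT-numerator ts

    evalᵀ-Πβ : ∀ ts c {bs} → SquareRoots c ts bs → evalᵀ ts (Πβ ts) c bs ≡ + product bs
    evalᵀ-Πβ []       c []             = unit c
      where
      unit : ∀ c → 1ℤ + c * 0ℤ ≡ 1ℤ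
      unit = solve-∀
    evalᵀ-Πβ (t ∷ ts) c {β ∷ bs} (_ ∷ roots) = begin
        evalᵀ ts (0ᵀ ts) c bs + + β * evalᵀ ts (Πβ ts) c bs
          ≡⟨ cong₂ (λ u v → u + + β * v) (evalᵀ-0ᵀ ts c bs) (evalᵀ-Πβ ts c roots) ⟩
        0ℤ + + β * + product bs
          ≡⟨ ℤₚ.+-identityˡ _ ⟩
        + β * + product bs
          ≡⟨ ℤₚ.pos-* β (product bs) ⟨
        + (β ℕ.* product bs)
          ∎
      where open ≡-Reasoning

    Inverses : List ℕ → Set
    Inverses = All (λ β → + β * + invMod p β ≈ 1ℤ)

    evalᵀ-numerator : ∀ ts c {bs} → SquareRoots c ts bs → Inverses bs →
                      evalᵀ ts (numerator ts) c bs ≈ + product bs * (w - mjj p ℓ (zip ts bs) 1)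
    evalᵀ-numerator []       c []                    []            = ≈-reflexive (constant w c)
      where
      constant : ∀ w c → w + c * 0ℤ ≡ 1ℤ * (w - 0ℤ)
      constant = solve-∀
    evalᵀ-numerator (t ∷ ts) c {β ∷ bs} (β² ∷ roots) (βI≈1 ∷ invs) = begin
        evalᵀ ts (scale ts (- ℓ t ∷ []) (Πβ ts)) c bs + + β * evalᵀ ts (numerator ts) c bs
      ≈⟨ +-cong (≈-reflexive (trans (evalᵀ-scale ts _ _ c bs) (cong (⟦ - ℓ t ∷ [] ⟧ c *_) (evalᵀ-Πβ ts c roots))))
                (*-cong (≈-refl {+ β}) (evalᵀ-numerator ts c roots invs)) ⟩
        (- ℓ t + c * 0ℤ) * P + + β * (P * (w - S))
      ≡⟨ expand (ℓ t) c P (+ β) w S ⟩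
        + β * P * w - P * ℓ t * 1ℤ - + β * P * S
      ≈⟨ +-cong (+-cong (≈-refl {+ β * P * w}) (-‿cong (*-cong (≈-refl {P * ℓ t}) (≈-sym βI≈1))))
                (≈-refl { - (+ β * P * S)}) ⟩
        + β * P * w - P * ℓ t * (+ β * I) - + β * P * S
      ≡⟨ factor (ℓ t) I P (+ β) w S ⟩
        + β * P * (w - (ℓ t * I + S))
      ≡⟨ cong₂ (λ u v → u * (w - (ℓ t * + v + S))) (ℤₚ.pos-* β (product bs)) (ℕₚ.*-identityʳ (invMod p β)) ⟨
        + (β ℕ.* product bs) * (w - (ℓ t * + (invMod p β ℕ.^ 1) + S))
      ∎
      where
      open import Relation.Binary.Reasoning.Setoid ≈-setoid
      P S I : ℤ
      P = + product bs
      S = mjj p ℓ (zip ts bs) 1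
      I = + invMod p β
      expand : ∀ l c P β w S → (- l + c * 0ℤ) * P + β * (P * (w - S)) ≡ β * P * w - P * l * 1ℤ - β * P * S
      expand = solve-∀
      factor : ∀ l I P β w S → β * P * w - P * l * (β * I) - β * P * S ≡ β * P * (w - (l * I + S))
      factor = solve-∀

  module NonVanishing {p : ℕ} (prime : Prime p) (ℓ : ℕ → ℤ) (w : ℤ) (τ₀ : ℕ) where
    open Congruence p
    open PrimeModulus prime
    open Polynomial
    open Tower
    open Numerator p ℓ w
    open Specialisation p (- + τ₀)

    c₀ : ℤ
    c₀ = - + τ₀

    a : Poly
    a = - ℓ τ₀ ∷ []

    normTop-numerator : ∀ M → Agree M (normTop τ₀ M (numerator (τ₀ ∷ M))) (embed M (a *ₚ a *ₚ ∏X+ M))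
    normTop-numerator M =
      agree-trans M (agree-add M (square-scaled-Πβ M a) (scale-by-≈0 M (- 1ℤ ·ₚ X+ τ₀) _ [-X-τ₀]≈0)) (add-0ᵀʳ M _)
      where
      [-X-τ₀]≈0 : ⟦ - 1ℤ ·ₚ X+ τ₀ ⟧ c₀ ≈ 0ℤ
      [-X-τ₀]≈0 = ≈-reflexive (begin
        ⟦ - 1ℤ ·ₚ X+ τ₀ ⟧ c₀    ≡⟨ ⟦·ₚ⟧ (- 1ℤ) (X+ τ₀) c₀ ⟩
        - 1ℤ * ⟦ X+ τ₀ ⟧ c₀     ≡⟨ cong (- 1ℤ *_) (trans (⟦X+⟧ τ₀ c₀) (ℤₚ.+-inverseˡ (+ τ₀))) ⟩
        - 1ℤ * 0ℤ               ≡⟨ ℤₚ.*-zeroʳ (- 1ℤ) ⟩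
        0ℤ                      ∎)
        where open ≡-Reasoning

    repeatedSquare≉0 : ∀ m q → ⟦ q ⟧ c₀ ≉ 0ℤ → ⟦ repeatedSquare m q ⟧ c₀ ≉ 0ℤ
    repeatedSquare≉0 zero    q q≉0 = q≉0
    repeatedSquare≉0 (suc m) q q≉0 =
      repeatedSquare≉0 m (q *ₚ q) (λ qq≈0 → x*y≉0 q≉0 q≉0 (≈-trans (≈-reflexive (sym (⟦*ₚ⟧ q q c₀))) qq≈0))

    ∏X+≉0 : ∀ M → All (λ σ → + σ ≉ + τ₀) M → ⟦ ∏X+ M ⟧ c₀ ≉ 0ℤ
    ∏X+≉0 []      []            1≈0 = 1≉0 (≈-trans (≈-reflexive (sym (unit c₀))) 1≈0)
      where
      unit : ∀ c → 1ℤ + c * 0ℤ ≡ 1ℤ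
      unit = solve-∀
    ∏X+≉0 (σ ∷ M) (σ≉τ₀ ∷ M≉τ₀) ∏≈0 =
      x*y≉0 X+σ≉0 (∏X+≉0 M M≉τ₀) (≈-trans (≈-reflexive (sym (⟦*ₚ⟧ (X+ σ) (∏X+ M) c₀))) ∏≈0)
      where
      X+σ≉0 : ⟦ X+ σ ⟧ c₀ ≉ 0ℤ
      X+σ≉0 X+σ≈0 = σ≉τ₀ (mk (subst (+ p ∣_) (difference (+ σ) (+ τ₀)) (≈0⇒∣ X+σ≈0)))
        where
        difference : ∀ s t → s + - t * (1ℤ + - t * 0ℤ) ≡ s - t
        difference = solve-∀

    numerator-norm≉0 : ∀ M → ℓ τ₀ ≉ 0ℤ → All (λ σ → + σ ≉ + τ₀) M →
                       ⟦ norm (τ₀ ∷ M) (numerator (τ₀ ∷ M)) ⟧ c₀ ≉ 0ℤ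
    numerator-norm≉0 M ℓτ₀≉0 M≉τ₀ norm≈0 =
      repeatedSquare≉0 (length M) (a *ₚ a *ₚ ∏X+ M) Q≉0
        (≈-trans (≈-sym (norm-embed M _)) (≈-trans (≈-sym (agree-norm M (normTop-numerator M))) norm≈0))
      where
      a≉0 : ⟦ a ⟧ c₀ ≉ 0ℤ
      a≉0 a≈0 = ℓτ₀≉0 (∣⇒≈0 (subst (+ p ∣_) (negated (ℓ τ₀) c₀) (∣m⇒∣-m (≈0⇒∣ a≈0))))
        where
        negated : ∀ l c → - (- l + c * 0ℤ) ≡ l
        negated = solve-∀
      Q≉0 : ⟦ a *ₚ a *ₚ ∏X+ M ⟧ c₀ ≉ 0ℤ
      Q≉0 Q≈0 = x*y≉0 (x*y≉0 a≉0 a≉0) (∏X+≉0 M M≉τ₀)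
        (≈-trans (≈-reflexive (sym (trans (⟦*ₚ⟧ (a *ₚ a) (∏X+ M) c₀) (cong (_* ⟦ ∏X+ M ⟧ c₀) (⟦*ₚ⟧ a a c₀)))))
                 Q≈0)

  count : ∀ {A : Set} → (A → Bool) → List A → ℕ
  count f xs = length (filterᵇ f xs)

  count-∨ : ∀ {A : Set} (f g : A → Bool) xs → count (λ x → f x ∨ g x) xs ℕ.≤ count f xs ℕ.+ count g xs
  count-∨ f g []       = z≤n
  count-∨ f g (x ∷ xs) with f x | g x
  ... | true  | true  =
    s≤s (ℕₚ.≤-trans (count-∨ f g xs) (ℕₚ.≤-trans (ℕₚ.n≤1+n _) (ℕₚ.≤-reflexive (sym (ℕₚ.+-suc _ _)))))
  ... | true  | false = s≤s (count-∨ f g xs)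
  ... | false | true  = ℕₚ.≤-trans (s≤s (count-∨ f g xs)) (ℕₚ.≤-reflexive (sym (ℕₚ.+-suc _ _)))
  ... | false | false = count-∨ f g xs

  count-mono : ∀ {A : Set} (f g : A → Bool) xs → (∀ x → T (f x) → T (g x)) → count f xs ℕ.≤ count g xs
  count-mono f g []       f⇒g = z≤n
  count-mono f g (x ∷ xs) f⇒g with f x in fx | g x in gx
  ... | true  | true  = s≤s (count-mono f g xs f⇒g)
  ... | true  | false = ⊥-elim (subst T gx (f⇒g x (subst T (sym fx) _)))
  ... | false | true  = ℕₚ.m≤n⇒m≤1+n (count-mono f g xs f⇒g)
  ... | false | false = count-mono f g xs f⇒g

  module Residues {p : ℕ} (prime : Prime p) where
    open Congruence p
    open PrimeModulus prime

    Separated : List ℕ → Set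
    Separated = AllPairs (λ a b → + a ≉ + b)

    hits : List ℕ → ℕ → Bool
    hits L r = any (λ τ → congᵇ p τ r) L

    count-congᵇ≤1 : ∀ x R → Separated R → count (congᵇ p x) R ℕ.≤ 1
    count-congᵇ≤1 x []       _              = z≤n
    count-congᵇ≤1 x (r ∷ R) (r≉R ∷ sep) with congᵇ p x r in x≡r
    ... | true  = s≤s (ℕₚ.≤-reflexive (cong length (filter-none (T? ∘ congᵇ p x) {R} (All.map x≢ r≉R))))
      where
      x≢ : ∀ {r′} → + r ≉ + r′ → ¬ T (congᵇ p x r′)
      x≢ r≉r′ x≡r′ = r≉r′ (≈-trans (≈-sym (congᵇ-sound x r (subst T (sym x≡r) _))) (congᵇ-sound x _ x≡r′))
    ... | false = count-congᵇ≤1 x R sep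

    count-hits≤ : ∀ R L → Separated R → count (hits L) R ℕ.≤ length L
    count-hits≤ R []       _   = ℕₚ.≤-reflexive (cong length (filter-none (T? ∘ hits []) {R} (All.tabulate (λ _ ()))))
    count-hits≤ R (x ∷ L) sep = ℕₚ.≤-trans (count-∨ (congᵇ p x) (hits L) R)
                                           (ℕₚ.+-mono-≤ (count-congᵇ≤1 x R sep) (count-hits≤ R L sep))

    count-hits≡⇒separated : ∀ R L → Separated R → count (hits L) R ≡ length L → Separated L
    count-hits≡⇒separated R []      sep _  = []
    count-hits≡⇒separated R (x ∷ L) sep eq = All.tabulate x≉L ∷ count-hits≡⇒separated R L sep eqL
      where
      eqL : count (hits L) R ≡ length L
      eqL = ℕₚ.≤-antisym (count-hits≤ R L sep)
              (ℕₚ.+-cancelˡ-≤ 1 _ _ (ℕₚ.≤-trans (ℕₚ.≤-reflexive (sym eq))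
                (ℕₚ.≤-trans (count-∨ (congᵇ p x) (hits L) R) (ℕₚ.+-monoˡ-≤ _ (count-congᵇ≤1 x R sep)))))
      x≉L : ∀ {y} → y ∈ L → + x ≉ + y
      x≉L {y} y∈L x≈y = ℕₚ.<-irrefl refl (begin-strict
          length L                 <⟨ ℕₚ.n<1+n (length L) ⟩
          length (x ∷ L)           ≡⟨ eq ⟨
          count (hits (x ∷ L)) R   ≤⟨ count-mono (hits (x ∷ L)) (hits L) R redundant ⟩
          count (hits L) R         ≤⟨ count-hits≤ R L sep ⟩
          length L                 ∎)
        where
        open ℕₚ.≤-Reasoning
        redundant : ∀ r → T (hits (x ∷ L) r) → T (hits L r)
        redundant r hit with congᵇ p x r in x≡r
        ... | true  = any⁺ (λ τ → congᵇ p τ r) (Any.map (λ { refl → congᵇ-complete y r y≈r }) y∈L)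
          where
          y≈r : + y ≈ + r
          y≈r = ≈-trans (≈-sym x≈y) (congᵇ-sound x r (subst T (sym x≡r) _))
        ... | false = hit

    upTo-separated : Separated (upTo p)
    upTo-separated = APₚ.applyUpTo⁺₁ (λ i → i) p (λ i<j j<p → ≉-sym (m<n<p⇒n≉m i<j j<p))
      where
      ≉-sym : ∀ {a b} → + b ≉ + a → + a ≉ + b
      ≉-sym b≉a a≈b = b≉a (≈-sym a≈b)

    Tlist-separated : ∀ n μ → cardT p n μ ≡ cardTbar p n μ → Separated (Tlist p n μ)
    Tlist-separated n μ eq = count-hits≡⇒separated (upTo p) (Tlist p n μ) upTo-separated (sym eq)

  count-map : ∀ {A B : Set} (f : B → Bool) (g : A → B) xs → count f (map g xs) ≡ count (f ∘ g) xs
  count-map f g []       = refl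
  count-map f g (x ∷ xs) with f (g x)
  ... | true  = cong suc (count-map f g xs)
  ... | false = count-map f g xs

  AllPairs-map-All : ∀ {A : Set} {P : A → Set} {R S : A → A → Set} →
                     (∀ {x y} → P x → P y → R x y → S x y) → ∀ {xs} → All P xs → AllPairs R xs → AllPairs S xs
  AllPairs-map-All f []         []           = []
  AllPairs-map-All f (px ∷ pxs) (Rx ∷ Rxs) = All.zipWith (λ { (py , r) → f px py r }) (pxs , Rx) ∷ AllPairs-map-All f pxs Rxs

  All-rotate : ∀ {A : Set} {P : A → Set} xs {x ys} → All P (xs ++ x ∷ ys) → All P (x ∷ xs ++ ys)
  All-rotate xs h with Allₚ.++⁻ xs h
  ... | pxs , px ∷ pys = px ∷ Allₚ.++⁺ pxs pys

  Pointwise-++∷⁻ : ∀ {A B : Set} {R : A → B → Set} xs {x ys bs} → Pointwise R (xs ++ x ∷ ys) bs →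
                   ∃ λ bxs → ∃ λ b → ∃ λ bys → bs ≡ bxs ++ b ∷ bys × Pointwise R xs bxs × R x b × Pointwise R ys bys
  Pointwise-++∷⁻ []       (r ∷ rs) = [] , _ , _ , refl , [] , r , rs
  Pointwise-++∷⁻ (_ ∷ xs) (r ∷ rs) with Pointwise-++∷⁻ xs rs
  ... | bxs , b , bys , refl , rxs , rx , rys = _ ∷ bxs , b , bys , refl , r ∷ rxs , rx , rys

  AllPairs-++∷⁻ : ∀ {A : Set} {R : A → A → Set} xs {x ys} → AllPairs R (xs ++ x ∷ ys) →
                  All (λ y → R y x) xs × All (R x) ys
  AllPairs-++∷⁻ []       (Rx ∷ _)   = [] , Rx
  AllPairs-++∷⁻ (y ∷ xs) (Ry ∷ Rxs) with AllPairs-++∷⁻ xs Rxs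
  ... | Rxs-x , Rx-ys = All.head (Allₚ.++⁻ʳ xs Ry) ∷ Rxs-x , Rx-ys

  tuples-shape : ∀ k (vs : List ℕ) → All (λ bs → length bs ≡ k × All (_∈ vs) bs) (tuples k vs)
  tuples-shape zero    vs = (refl , []) ∷ []
  tuples-shape (suc k) vs = Allₚ.concat⁺ (Allₚ.map⁺ (All.tabulate λ v∈vs →
    Allₚ.map⁺ (All.map (λ { (len , ∈vs) → cong suc len , v∈vs ∷ ∈vs }) (tuples-shape k vs))))

  tuples-unique : ∀ k {vs : List ℕ} → Unique vs → Unique (tuples k vs)
  tuples-unique zero    _         = [] ∷ []
  tuples-unique (suc k) {vs} vs! = Uniqueₚ.concat⁺
      (Allₚ.map⁺ (All.universal (λ _ → Uniqueₚ.map⁺ ∷-injectiveʳ (tuples-unique k vs!)) vs))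
      (APₚ.map⁺ (AllPairs.map disjoint vs!))
    where
    disjoint : ∀ {v v′} → v ≢ v′ → Disjoint (map (v ∷_) (tuples k vs)) (map (v′ ∷_) (tuples k vs))
    disjoint v≢v′ (u∈ , u∈′) with ∈-map⁻ _ u∈ | ∈-map⁻ _ u∈′
    ... | _ , _ , refl | _ , _ , eq = v≢v′ (∷-injectiveˡ eq)

  module Counting {p : ℕ} (prime : Prime p) (n : ℕ) (ℓ : ℕ → ℤ) (w : ℤ) where
    open Congruence p
    open PrimeModulus prime
    open RootBound prime
    open Polynomial
    open Tower
    open TowerRoots p
    open Numerator p ℓ w
    open Residues prime

    Good : List (ℕ × ℕ) → Set
    Good tb = T (goodᵇ p n ℓ w tb)

    commonShift : List (ℕ × ℕ) → ℤ
    commonShift []       = 0ℤ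
    commonShift (x ∷ tb) = shift x

    good⇒shifts≈ : ∀ tb → Good tb → All (λ x → shift x ≈ commonShift tb) tb
    good⇒shifts≈ []       _    = []
    good⇒shifts≈ (x ∷ tb) good = All.map (λ diffs → mk (dvdℤ-sound _ (All.head (Allₚ.all⁺ _ (x ∷ tb) diffs))))
                                         (Allₚ.all⁺ _ (x ∷ tb) pairwise)
      where
      everyPair : ℕ × ℕ → Bool
      everyPair y = all (λ z → dvdℤ p (shift y - shift z)) (x ∷ tb)
      pairwise : T (all everyPair (x ∷ tb))
      pairwise = proj₁ (Equivalence.to (T-∧ {all everyPair (x ∷ tb)})
                                        (proj₁ (Equivalence.to (T-∧ {inB p (x ∷ tb)}) good)))

    good⇒mjj≈w : ∀ tb → Good tb → w - mjj p ℓ tb 1 ≈ 0ℤ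
    good⇒mjj≈w tb good = ∣⇒≈0 (subst (+ p ∣_) (negate (mjj p ℓ tb 1) w) (∣m⇒∣-m (dvdℤ-sound _ mjj≡w)))
      where
      mjj≡w : T (dvdℤ p (mjj p ℓ tb 1 - w))
      mjj≡w = proj₁ (Equivalence.to (T-∧ {dvdℤ p (mjj p ℓ tb 1 - w)}) (proj₂ (Equivalence.to (T-∧ {inB p tb}) good)))
      negate : ∀ m w → - (m - w) ≡ w - m
      negate = solve-∀

    shifts⇒SquareRoots : ∀ ts {bs c} → length ts ≡ length bs → All (λ x → shift x ≈ c) (zip ts bs) →
                         SquareRoots c ts bs
    shifts⇒SquareRoots []       {[]}     _   _            = []
    shifts⇒SquareRoots (t ∷ ts) {β ∷ bs} len (mk d ∷ ds) =
      mk (subst (+ p ∣_) (regroup β t _) d) ∷ shifts⇒SquareRoots ts (ℕₚ.suc-injective len) ds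
      where
      rearrange : ∀ b t c → b - t - c ≡ b - (c + t)
      rearrange = solve-∀
      regroup : ∀ β t c → + (β ℕ.* β) - + t - c ≡ + β * + β - (c + + t)
      regroup β t c = trans (cong (λ b → b - + t - c) (ℤₚ.pos-* β β)) (rearrange (+ β * + β) (+ t) c)

    H : List ℕ
    H = halfRange p

    H-unique : Unique H
    H-unique = Uniqueₚ.map⁺ ℕₚ.suc-injective (Uniqueₚ.upTo⁺ _)

    square-roots-unique : ∀ {ts bs bs′ c c′} → All (_∈ H) bs → All (_∈ H) bs′ →
                          SquareRoots c ts bs → SquareRoots c′ ts bs′ → c ≈ c′ → bs ≡ bs′
    square-roots-unique []           []             []         []           _    = refl
    square-roots-unique (β∈ ∷ bs∈) (β′∈ ∷ bs′∈) (β² ∷ roots) (β′² ∷ roots′) c≈c′ =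
      cong₂ _∷_ (halfRange-square-injective β∈ β′∈ (≈-trans β² (≈-trans (+-cong c≈c′ ≈-refl) (≈-sym β′²))))
                (square-roots-unique bs∈ bs′∈ roots roots′ c≈c′)

    mjj-rotate : ∀ {R : ℕ → ℕ → Set} {xs x ys bxs b bys} j → Pointwise R xs bxs →
                 mjj p ℓ (zip (x ∷ xs ++ ys) (b ∷ bxs ++ bys)) j ≡ mjj p ℓ (zip (xs ++ x ∷ ys) (bxs ++ b ∷ bys)) j
    mjj-rotate j []                 = refl
    mjj-rotate {xs = x′ ∷ xs} {x} {ys} {b′ ∷ bxs} {b} {bys} j (_ ∷ rs) =
      trans (swap (term (x , b)) (term (x′ , b′)) (mjj p ℓ (zip (xs ++ ys) (bxs ++ bys)) j))
            (cong (λ s → term (x′ , b′) + s) (mjj-rotate j rs))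
      where
      term : ℕ × ℕ → ℤ
      term (t , β) = ℓ t * + (invMod p β ℕ.^ (2 ℕ.* j ℕ.∸ 1))
      swap : ∀ a b c → a + (b + c) ≡ b + (a + c)
      swap = solve-∀

    module _ (Tpre : List ℕ) (τ₀ : ℕ) (Tpost : List ℕ) where

      private
        Tτ₀ M : List ℕ
        Tτ₀ = Tpre ++ τ₀ ∷ Tpost
        M = Tpre ++ Tpost

      P : Poly
      P = norm (τ₀ ∷ M) (numerator (τ₀ ∷ M))

      -- τ₀ is moved to the top of the tower, where NonVanishing needs it.
      good-root : ∀ {bs} → length bs ≡ length Tτ₀ → All (_∈ H) bs → Good (zip Tτ₀ bs) →
                  ⟦ P ⟧ (commonShift (zip Tτ₀ bs)) ≈ 0ℤ
      good-root {bs} len bs∈H good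
        with Pointwise-++∷⁻ Tpre (shifts⇒SquareRoots Tτ₀ (sym len) (good⇒shifts≈ (zip Tτ₀ bs) good))
      ... | bpre , b , bpost , refl , roots-pre , root , roots-post =
        norm-root (τ₀ ∷ M) (numerator (τ₀ ∷ M)) c {bs′} (root ∷ Pointwise.++⁺ roots-pre roots-post) (begin
          evalᵀ (τ₀ ∷ M) (numerator (τ₀ ∷ M)) c bs′
            ≈⟨ evalᵀ-numerator (τ₀ ∷ M) c (root ∷ Pointwise.++⁺ roots-pre roots-post) inverses ⟩
          + product bs′ * (w - mjj p ℓ (zip (τ₀ ∷ M) bs′) 1)
            ≡⟨ cong (λ m → + product bs′ * (w - m)) (mjj-rotate 1 roots-pre) ⟩
          + product bs′ * (w - mjj p ℓ (zip Tτ₀ bs) 1)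
            ≈⟨ *-cong (≈-refl {+ product bs′}) (good⇒mjj≈w (zip Tτ₀ bs) good) ⟩
          + product bs′ * 0ℤ
            ≡⟨ ℤₚ.*-zeroʳ (+ product bs′) ⟩
          0ℤ ∎)
        where
        open import Relation.Binary.Reasoning.Setoid ≈-setoid
        c : ℤ
        c = commonShift (zip Tτ₀ bs)
        bs′ : List ℕ
        bs′ = b ∷ bpre ++ bpost
        inverses : Inverses bs′
        inverses = All.map (λ β∈H → invMod-inverse (proj₁ (∈-halfRange⁻ β∈H)) (∈-halfRange⇒<p β∈H))
                           (All-rotate bpre bs∈H)

      good-count≤ : Separated Tτ₀ → ℓ τ₀ ≉ 0ℤ →
                    count (goodᵇ p n ℓ w) (map (zip Tτ₀) (tuples (length Tτ₀) H)) ℕ.≤ normDegree (length Tτ₀) 0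
      good-count≤ sep ℓτ₀≉0 = begin
        count (goodᵇ p n ℓ w) (map (zip Tτ₀) (tuples k H))  ≡⟨ count-map (goodᵇ p n ℓ w) (zip Tτ₀) (tuples k H) ⟩
        length G                                           ≡⟨ length-map (commonShift ∘ zip Tτ₀) G ⟨
        length roots                                       ≤⟨ ℕₚ.≤-pred (ℕₚ.<-≤-trans fewer-roots deg-P) ⟩
        normDegree k 0                                     ∎
        where
        open ℕₚ.≤-Reasoning
        k : ℕ
        k = length Tτ₀
        G : List (List ℕ)
        G = filterᵇ (goodᵇ p n ℓ w ∘ zip Tτ₀) (tuples k H)
        roots : List ℤ
        roots = map (commonShift ∘ zip Tτ₀) G
        admissible : All (λ bs → (length bs ≡ k × All (_∈ H) bs) × Good (zip Tτ₀ bs)) G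
        admissible = All.zip (Allₚ.filter⁺ _ (tuples-shape k H) , Allₚ.all-filter _ (tuples k H))
        distinct-shifts : ∀ {bs bs′} → (length bs ≡ k × All (_∈ H) bs) × Good (zip Tτ₀ bs) →
                          (length bs′ ≡ k × All (_∈ H) bs′) × Good (zip Tτ₀ bs′) → bs ≢ bs′ →
                          commonShift (zip Tτ₀ bs) ≉ commonShift (zip Tτ₀ bs′)
        distinct-shifts {bs} {bs′} ((len , bs∈H) , good) ((len′ , bs′∈H) , good′) bs≢bs′ c≈c′ =
          bs≢bs′ (square-roots-unique bs∈H bs′∈H
                    (shifts⇒SquareRoots Tτ₀ (sym len) (good⇒shifts≈ (zip Tτ₀ bs) good))
                    (shifts⇒SquareRoots Tτ₀ (sym len′) (good⇒shifts≈ (zip Tτ₀ bs′) good′)) c≈c′)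
        separated : AllPairs _≉_ roots
        separated = APₚ.map⁺ (AllPairs-map-All distinct-shifts admissible
                                (APₚ.filter⁺ _ (tuples-unique k H-unique)))
        roots-of-P : All (λ r → ⟦ P ⟧ r ≈ 0ℤ) roots
        roots-of-P = Allₚ.map⁺ (All.map (λ { ((len , bs∈H) , good) → good-root len bs∈H good }) admissible)
        P≉0 : ⟦ P ⟧ (- + τ₀) ≉ 0ℤ
        P≉0 with AllPairs-++∷⁻ Tpre sep
        ... | pre≉τ₀ , τ₀≉post =
          NonVanishing.numerator-norm≉0 prime ℓ w τ₀ M ℓτ₀≉0
            (Allₚ.++⁺ pre≉τ₀ (All.map (λ τ₀≉σ σ≈τ₀ → τ₀≉σ (≈-sym σ≈τ₀)) τ₀≉post))
        fewer-roots : length roots ℕ.< length P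
        fewer-roots = roots-bound {as = P} separated roots-of-P P≉0
        deg-P : length P ℕ.≤ suc (normDegree k 0)
        deg-P = subst (λ m → length P ℕ.≤ suc (normDegree m 0)) length-rotate
                      (deg-norm (τ₀ ∷ M) (degT-numerator (τ₀ ∷ M)))
          where
          length-rotate : length (τ₀ ∷ M) ≡ k
          length-rotate = begin-equality
            suc (length (Tpre ++ Tpost))          ≡⟨ cong suc (length-++ Tpre) ⟩
            suc (length Tpre ℕ.+ length Tpost)    ≡⟨ ℕₚ.+-suc (length Tpre) (length Tpost) ⟨
            length Tpre ℕ.+ length (τ₀ ∷ Tpost)   ≡⟨ length-++ Tpre ⟨
            k                                     ∎

    good-count-bound : ∀ {Tτ₀ τ₀} → Separated Tτ₀ → τ₀ ∈ Tτ₀ → ℓ τ₀ ≉ 0ℤ →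
                       count (goodᵇ p n ℓ w) (map (zip Tτ₀) (tuples (length Tτ₀) H))
                         ℕ.≤ length Tτ₀ ℕ.* 2 ℕ.^ length Tτ₀
    good-count-bound {τ₀ = τ₀} sep τ₀∈ ℓτ₀≉0 with ∈-∃++ τ₀∈
    ... | Tpre , Tpost , refl = begin
        count (goodᵇ p n ℓ w) (map (zip Tτ₀) (tuples k H)) ≤⟨ good-count≤ Tpre τ₀ Tpost sep ℓτ₀≉0 ⟩
        normDegree k 0                                      ≤⟨ normDegree≤ k 0 ⟩
        2 ℕ.^ k ℕ.* k                                       ≡⟨ ℕₚ.*-comm (2 ℕ.^ k) k ⟩
        k ℕ.* 2 ℕ.^ k                                       ∎
      where
      open ℕₚ.≤-Reasoning
      Tτ₀ : List ℕ
      Tτ₀ = Tpre ++ τ₀ ∷ Tpost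
      k : ℕ
      k = length Tτ₀

open import Data.Nat using (ℕ; _*_; _^_; _≤_; _<_)
open import Data.Nat.Primality using (Prime)
open import Data.Integer using (ℤ; ∣_∣)
open import Data.List.Membership.Propositional using (_∈_)
open import Data.Product using (Σ; ∃; _×_; _,_)
open import Relation.Binary.PropositionalEquality using (_≡_; _≢_; cong; sym)
open import Data.Nat.Properties using (≤-trans; ≤-reflexive; *-identityˡ)

lemma2p2 : Σ ℕ λ C →
    (p n : ℕ) (μ : ℕ → ℕ) (ℓ : ℕ → ℤ) (w : ℤ) →
    Prime p → p ≢ 2 → 2 ≤ n →
    cardT p n μ ≡ cardTbar p n μ →
    (∀ τ → τ ∈ Tlist p n μ → ∣ ℓ τ ∣ < p) →
    (∃ λ τ → τ ∈ Tlist p n μ × ℓ τ ≢ Data.Integer.+ 0) →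
    Ncount p n μ ℓ w ≤ C * cardT p n μ * 2 ^ cardT p n μ
lemma2p2 = 1 , λ p n μ ℓ w prime _ _ cardT≡cardTbar ∣ℓ∣<p (τ₀ , τ₀∈T , ℓτ₀≢0) →
  ≤-trans (Counting.good-count-bound prime n ℓ w (Residues.Tlist-separated prime n μ cardT≡cardTbar) τ₀∈T
             (PrimeModulus.∣z∣<p⇒z≉0 prime ℓτ₀≢0 (∣ℓ∣<p τ₀ τ₀∈T)))
          (≤-reflexive (cong (_* 2 ^ cardT p n μ) (sym (*-identityˡ (cardT p n μ)))))
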